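{- Let \[ A=\begin{pmatrix} 1&1&1&0&0&0\\ 1&0&0&1&1&0\\ 0&1&0&1&0&1\\ 0&0&1&0&1&1 \end{pmatrix} \] be the incidence matrix of the complete graph $K_4$ (without self-loops). Then \[ \max_{\mathbf b\in\mathbb N A}\mathrm{MD}(A_{\mathbf b})=\mathrm{MC}(A)=2. \]
   Context: $\mathbb N A=\{A\mathbf x\mid\mathbf x\in\mathbb N^6\}$; for $\mathbf b\in\mathbb NA$, $\mathcal F_{A,\mathbf b}=\{\mathbf x\in\mathbb N^6\mid A\mathbf x=\mathbf b\}$ and $A_{\mathbf b}$ is the matrix whose columns are the elements of $\mathcal F_{A,\mathbf b}$. For a configuration $B$, a move is an element of $\ker_{\mathbb Z}B$, its degree is the 1-norm of its positive part, a Markov basis is a set of moves connecting every fiber $\{\mathbf x\ge 0 \text{ integer}\mid B\mathbf x=\mathbf b'\}$ (staying inside the fiber), and $\mathrm{MD}(B)$ is the minimum $m$ such that moves of degree at most $m$ form a Markov basis. The $N$-th Lawrence lifting $A^{(N)}$ maps $(\mathbf x_1,\dots,\mathbf x_N)$ to $(A\mathbf x_1,\dots,A\mathbf x_N,\sum_k\mathbf x_k)$; the type of a move $(\mathbf z_1,\dots,\mathbf z_N)$ of $A^{(N)}$ is the number of nonzero $\mathbf z_k$; $\mathrm{MC}(A)$ is the minimum $m$ such that for every $N\ge 1$ the moves of type at most $m$ form a Markov basis of $A^{(N)}$. -}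

module Defs where

open import Data.Nat as ℕ using (ℕ; zero; suc; _≤_)
open import Data.Integer as ℤ using (ℤ; +_; -[1+_])
open import Data.Bool using (Bool; true; false; if_then_else_)
open import Data.Fin using (Fin; zero; suc)
open import Data.Fin.Properties using () renaming (_≟_ to _≟ᶠ_)
open import Data.Vec using (Vec; []; _∷_; replicate; map; zipWith; concat; tabulate; lookup; take; drop; _++_)
open import Data.Vec.Membership.Propositional using (_∈_)
open import Data.Product using (Σ; _×_; ∃)
open import Function.Bundles using (_⇔_)
open import Relation.Nullary using (does)
open import Relation.Binary.PropositionalEquality using (_≡_)
open import Relation.Binary.Construct.Closure.ReflexiveTransitive using (Star)

-- A configuration with d rows and n columns, given as its list of columns.
Config : ℕ → ℕ → Set
Config d n = Vec (Vec ℕ d) n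

toℤ : ∀ {n} → Vec ℕ n → Vec ℤ n
toℤ = map +_

zeroℤ : ∀ n → Vec ℤ n
zeroℤ n = replicate n (+ 0)

_·_ : ∀ {d n} → Config d n → Vec ℤ n → Vec ℤ d
_·_ {d} [] [] = zeroℤ d
(c ∷ B) · (z ∷ zs) = zipWith ℤ._+_ (map (λ a → z ℤ.* (+ a)) c) (B · zs)

IsMove : ∀ {d n} → Config d n → Vec ℤ n → Set
IsMove {d} B z = B · z ≡ zeroℤ d

pos : ℤ → ℕ
pos (+ n) = n
pos -[1+ n ] = 0

deg : ∀ {n} → Vec ℤ n → ℕ
deg z = Data.Vec.sum (map pos z)

Step : ∀ {d n} → Config d n → Vec ℤ d → (Vec ℤ n → Set) → Vec ℕ n → Vec ℕ n → Set
Step B b' M x y =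
  (B · toℤ x ≡ b') × (B · toℤ y ≡ b') ×
  (M (zipWith ℤ._-_ (toℤ y) (toℤ x)) Data.Sum.⊎ M (zipWith ℤ._-_ (toℤ x) (toℤ y)))
  where import Data.Sum

IsMarkovBasis : ∀ {d n} → Config d n → (Vec ℤ n → Set) → Set
IsMarkovBasis {d} {n} B M =
  ∀ (b' : Vec ℤ d) (x y : Vec ℕ n) → B · toℤ x ≡ b' → B · toℤ y ≡ b' → Star (Step B b' M) x y

MovesDeg≤ : ∀ {d n} → Config d n → ℕ → Vec ℤ n → Set
MovesDeg≤ B m z = IsMove B z × deg z ≤ m

IsMD : ∀ {d n} → Config d n → ℕ → Set
IsMD B m = IsMarkovBasis B (MovesDeg≤ B m) × (∀ m' → IsMarkovBasis B (MovesDeg≤ B m') → m ≤ m')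

InNA : ∀ {d n} → Config d n → Vec ℕ d → Set
InNA {d} {n} A b = ∃ λ (x : Vec ℕ n) → A · toℤ x ≡ toℤ b

-- C is (an enumeration without repetition of) the matrix A_b whose columns are the fiber F_{A,b}
IsFiberMatrix : ∀ {d n k} → Config d n → Vec ℕ d → Config n k → Set
IsFiberMatrix A b C =
  (∀ x → (A · toℤ x ≡ toℤ b) ⇔ (x ∈ C)) ×
  (∀ i j → lookup C i ≡ lookup C j → i ≡ j)

-- N-th Lawrence lifting: columns indexed by (k , j), ordered block by block
unitVec : ∀ {n} → Fin n → Vec ℕ n
unitVec j = tabulate (λ j' → if does (j' ≟ᶠ j) then 1 else 0)

lawrenceCol : ∀ {d n} N → Config d n → Fin N → Fin n → Vec ℕ (N ℕ.* d ℕ.+ n)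
lawrenceCol {d} N A k j =
  concat (tabulate (λ k' → if does (k' ≟ᶠ k) then lookup A j else replicate d 0)) ++ unitVec j

Lawrence : ∀ {d n} N → Config d n → Config (N ℕ.* d ℕ.+ n) (N ℕ.* n)
Lawrence N A = concat (tabulate (λ k → tabulate (λ j → lawrenceCol N A k j)))

blocks : ∀ {A : Set} N n → Vec A (N ℕ.* n) → Vec (Vec A n) N
blocks zero n xs = []
blocks (suc N) n xs = take n xs ∷ blocks N n (drop n xs)

isZeroVec : ∀ {n} → Vec ℤ n → Bool
isZeroVec [] = true
isZeroVec (+ zero ∷ xs) = isZeroVec xs
isZeroVec (+ suc _ ∷ xs) = false
isZeroVec (-[1+ _ ] ∷ xs) = false

typeOf : ∀ N n → Vec ℤ (N ℕ.* n) → ℕ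
typeOf N n z = Data.Vec.sum (map (λ w → if isZeroVec w then 0 else 1) (blocks N n z))

MovesType≤ : ∀ {d n} N → Config d n → ℕ → Vec ℤ (N ℕ.* n) → Set
MovesType≤ {n = n} N A m z = IsMove (Lawrence N A) z × typeOf N n z ≤ m

MCbound : ∀ {d n} → Config d n → ℕ → Set
MCbound A m = ∀ N → 1 ≤ N → IsMarkovBasis (Lawrence N A) (MovesType≤ N A m)

IsMC : ∀ {d n} → Config d n → ℕ → Set
IsMC A m = MCbound A m × (∀ m' → MCbound A m' → m ≤ m')

A-K4 : Config 4 6
A-K4 =
  (1 ∷ 1 ∷ 0 ∷ 0 ∷ []) ∷
  (1 ∷ 0 ∷ 1 ∷ 0 ∷ []) ∷
  (1 ∷ 0 ∷ 0 ∷ 1 ∷ []) ∷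
  (0 ∷ 1 ∷ 1 ∷ 0 ∷ []) ∷
  (0 ∷ 1 ∷ 0 ∷ 1 ∷ []) ∷
  (0 ∷ 0 ∷ 1 ∷ 1 ∷ []) ∷ []

module Submission where

-- A table is a list of points; a swap step
-- redistributes p ⊕ r between two rows p, r keeping both A-images.  `swapConnected-K4`: two
-- tables with the same row images and the same total are joined by swap steps.  If the first
-- rows p ≠ q differ, p is heavier than q on some perfect matching and lighter at another;
-- trading these matchings with a suitable later row brings p closer to q, and once p = q we
-- recurse.  The rest is general, for any swap-connected A:
--  * MC(A) ≤ 2: by the product formula for Lawrence liftings, points of a fiber of A^(N) are
--    tables and swap steps are moves of type ≤ 2 (`mc≤2`); MC(A) ≥ 2 since two distinct points
--    of one fiber give (u,v), (v,u) in a fiber of A^(2), where type-1 moves vanish (`mc≥2`).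
--  * MD(A_b) ≤ 2 for A homogeneous: points of fibers of A_b are tables of points of F_{A,b}
--    and swap steps are quadratic moves, while degree-1 moves are trivial (`FiberMatrix`).
--  * b = (2,2,2,2) has a nontrivial quadratic relation, so MD(A_b) = 2 there.

open import Defs
open import Algebra.Bundles using (CommutativeMonoid)
open import Algebra.Structures using (IsCommutativeMonoid)
import Algebra.Solver.CommutativeMonoid as CommutativeMonoidSolver
open import Data.Bool using (true; false; if_then_else_)
open import Data.Empty using (⊥-elim)
open import Data.Fin using (Fin; zero; suc)
import Data.Fin.Properties as FinP
open import Data.Integer as ℤ using (ℤ; +_; _⊖_)
import Data.Integer.Properties as ℤP
import Data.Integer.Tactic.RingSolver as ℤSolver
open import Data.Nat using (ℕ; zero; suc; _+_; _*_; _∸_; _≤_; _<_; z≤n; s≤s; ∣_-_∣; ≢-nonZero)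
import Data.Nat.Properties as ℕP
import Data.Nat.Tactic.RingSolver as ℕSolver
open import Data.Product using (Σ; _×_; _,_; proj₁; proj₂)
open import Data.Sum using (inj₁; inj₂)
open import Data.Vec using (Vec; []; _∷_; replicate; map; zipWith; lookup; sum; tabulate; concat; _++_; take; drop)
open import Data.Vec.Properties
open import Data.Vec.Relation.Binary.Pointwise.Inductive using (Pointwise; []; _∷_)
open import Data.Vec.Relation.Unary.All using (All; []; _∷_)
open import Data.Vec.Relation.Unary.All.Properties using (++⁺)
import Data.Vec.Relation.Unary.Any as Any
open import Data.Vec.Membership.Propositional using (_∈_)
open import Function.Bundles using (Equivalence; mk⇔)
open import Relation.Nullary using (¬_; Dec; yes; no; does; ¬?; _×-dec_)
open import Relation.Binary.PropositionalEquality
open import Relation.Binary.Construct.Closure.ReflexiveTransitive using (Star; ε; _◅_; gmap)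

infixl 6 _⊕_
_⊕_ : ∀ {n} → Vec ℕ n → Vec ℕ n → Vec ℕ n
_⊕_ = zipWith _+_

0ᵛ : ∀ n → Vec ℕ n
0ᵛ n = replicate n 0

⊕-isCommutativeMonoid : ∀ n → IsCommutativeMonoid _≡_ (_⊕_ {n}) (0ᵛ n)
⊕-isCommutativeMonoid n = record
  { isMonoid = record
    { isSemigroup = record { isMagma = isMagma _⊕_ ; assoc = zipWith-assoc ℕP.+-assoc }
    ; identity = zipWith-identityˡ ℕP.+-identityˡ , zipWith-identityʳ ℕP.+-identityʳ }
  ; comm = zipWith-comm ℕP.+-comm }

⊕-commutativeMonoid : ℕ → CommutativeMonoid _ _
⊕-commutativeMonoid n = record { isCommutativeMonoid = ⊕-isCommutativeMonoid n }

module ⊕-Solver {n : ℕ} where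
  open CommutativeMonoidSolver (⊕-commutativeMonoid n) public using (solve; _⊜_) renaming (_⊕_ to _∙_)

⊕-identityˡ : ∀ {n} (u : Vec ℕ n) → 0ᵛ n ⊕ u ≡ u
⊕-identityˡ = zipWith-identityˡ ℕP.+-identityˡ

⊕-cancelʳ : ∀ {n} (u v w : Vec ℕ n) → u ⊕ w ≡ v ⊕ w → u ≡ v
⊕-cancelʳ [] [] [] _ = refl
⊕-cancelʳ (a ∷ u) (b ∷ v) (c ∷ w) e =
  cong₂ _∷_ (ℕP.+-cancelʳ-≡ c a b (∷-injectiveˡ e)) (⊕-cancelʳ u v w (∷-injectiveʳ e))

⊕-cancelˡ : ∀ {n} (w u v : Vec ℕ n) → w ⊕ u ≡ w ⊕ v → u ≡ v
⊕-cancelˡ w u v e = ⊕-cancelʳ u v w (trans (zipWith-comm ℕP.+-comm u w) (trans e (zipWith-comm ℕP.+-comm w v)))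

⊕-interchange : ∀ {n} (a b c d : Vec ℕ n) → (a ⊕ b) ⊕ (c ⊕ d) ≡ (a ⊕ c) ⊕ (b ⊕ d)
⊕-interchange = solve 4 (λ a b c d → (a ∙ b) ∙ (c ∙ d) ⊜ (a ∙ c) ∙ (b ∙ d)) refl
  where open ⊕-Solver

_⊙_ : ∀ {n} → ℕ → Vec ℕ n → Vec ℕ n
m ⊙ v = map (m *_) v

infixr 7 _·ℕ_
_·ℕ_ : ∀ {d n} → Config d n → Vec ℕ n → Vec ℕ d
_·ℕ_ {d} [] [] = 0ᵛ d
(c ∷ B) ·ℕ (z ∷ x) = z ⊙ c ⊕ B ·ℕ x

0⊙ : ∀ {n} (v : Vec ℕ n) → 0 ⊙ v ≡ 0ᵛ n
0⊙ v = map-const v 0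

1⊙ : ∀ {n} (v : Vec ℕ n) → 1 ⊙ v ≡ v
1⊙ v = trans (map-cong ℕP.*-identityˡ v) (map-id v)

⊙-distribʳ : ∀ {n} a b (v : Vec ℕ n) → (a + b) ⊙ v ≡ a ⊙ v ⊕ b ⊙ v
⊙-distribʳ a b [] = refl
⊙-distribʳ a b (x ∷ v) = cong₂ _∷_ (ℕP.*-distribʳ-+ x a b) (⊙-distribʳ a b v)

·ℕ-0ᵛ : ∀ {d n} (B : Config d n) → B ·ℕ 0ᵛ n ≡ 0ᵛ d
·ℕ-0ᵛ [] = refl
·ℕ-0ᵛ (c ∷ B) = trans (cong₂ _⊕_ (0⊙ c) (·ℕ-0ᵛ B)) (⊕-identityˡ _)

·ℕ-⊕ : ∀ {d n} (B : Config d n) (x y : Vec ℕ n) → B ·ℕ (x ⊕ y) ≡ B ·ℕ x ⊕ B ·ℕ y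
·ℕ-⊕ {d} [] [] [] = sym (⊕-identityˡ (0ᵛ d))
·ℕ-⊕ (c ∷ B) (a ∷ x) (b ∷ y) = begin
    (a + b) ⊙ c ⊕ B ·ℕ (x ⊕ y)            ≡⟨ cong₂ _⊕_ (⊙-distribʳ a b c) (·ℕ-⊕ B x y) ⟩
    (a ⊙ c ⊕ b ⊙ c) ⊕ (B ·ℕ x ⊕ B ·ℕ y)   ≡⟨ ⊕-interchange _ _ _ _ ⟩
    (a ⊙ c ⊕ B ·ℕ x) ⊕ (b ⊙ c ⊕ B ·ℕ y)   ∎
  where open ≡-Reasoning

unitVec-zero : ∀ n → unitVec {suc n} zero ≡ 1 ∷ 0ᵛ n
unitVec-zero n = cong (1 ∷_) (trans (tabulate-allFin _) (map-const _ 0))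

·ℕ-unitVec : ∀ {d n} (B : Config d n) (i : Fin n) → B ·ℕ unitVec i ≡ lookup B i
·ℕ-unitVec (c ∷ B) zero = begin
    B′ ·ℕ unitVec zero          ≡⟨ cong (B′ ·ℕ_) (unitVec-zero _) ⟩
    1 ⊙ c ⊕ B ·ℕ 0ᵛ _           ≡⟨ cong₂ _⊕_ (1⊙ c) (·ℕ-0ᵛ B) ⟩
    c ⊕ 0ᵛ _                    ≡⟨ zipWith-identityʳ ℕP.+-identityʳ c ⟩
    c                           ∎
  where open ≡-Reasoning
        B′ = c ∷ B
·ℕ-unitVec (c ∷ B) (suc i) = trans (cong₂ _⊕_ (0⊙ c) (·ℕ-unitVec B i)) (⊕-identityˡ _)

toℤ-⊙⊕ : ∀ {d} z (c v : Vec ℕ d) →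
  zipWith ℤ._+_ (map (λ a → + z ℤ.* + a) c) (toℤ v) ≡ toℤ (z ⊙ c ⊕ v)
toℤ-⊙⊕ z [] [] = refl
toℤ-⊙⊕ z (a ∷ c) (w ∷ v) = cong₂ _∷_ (cong (ℤ._+ + w) (sym (ℤP.pos-* z a))) (toℤ-⊙⊕ z c v)

toℤ-· : ∀ {d n} (B : Config d n) (x : Vec ℕ n) → B · toℤ x ≡ toℤ (B ·ℕ x)
toℤ-· {d} [] [] = sym (map-replicate +_ 0 d)
toℤ-· (c ∷ B) (z ∷ x) =
  trans (cong (zipWith ℤ._+_ (map (λ a → + z ℤ.* + a) c)) (toℤ-· B x)) (toℤ-⊙⊕ z c (B ·ℕ x))

toℤ-injective : ∀ {n} (u v : Vec ℕ n) → toℤ u ≡ toℤ v → u ≡ v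
toℤ-injective [] [] _ = refl
toℤ-injective (a ∷ u) (b ∷ v) e =
  cong₂ _∷_ (ℤP.+-injective (∷-injectiveˡ e)) (toℤ-injective u v (∷-injectiveʳ e))

·⇒·ℕ : ∀ {d n} (B : Config d n) {x y : Vec ℕ n} → B · toℤ x ≡ B · toℤ y → B ·ℕ x ≡ B ·ℕ y
·⇒·ℕ B {x} {y} e = toℤ-injective _ _ (trans (sym (toℤ-· B x)) (trans e (toℤ-· B y)))

·ℕ⇒· : ∀ {d n} (B : Config d n) {x y : Vec ℕ n} → B ·ℕ x ≡ B ·ℕ y → B · toℤ x ≡ B · toℤ y
·ℕ⇒· B {x} {y} e = trans (toℤ-· B x) (trans (cong toℤ e) (sym (toℤ-· B y)))

diff : ∀ {n} → Vec ℕ n → Vec ℕ n → Vec ℤ n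
diff y x = zipWith ℤ._-_ (toℤ y) (toℤ x)

-ᵛ-self : ∀ {n} (w : Vec ℤ n) → zipWith ℤ._-_ w w ≡ zeroℤ n
-ᵛ-self [] = refl
-ᵛ-self (a ∷ w) = cong₂ _∷_ (ℤP.+-inverseʳ a) (-ᵛ-self w)

diff-self : ∀ {n} (x : Vec ℕ n) → diff x x ≡ zeroℤ n
diff-self x = -ᵛ-self (toℤ x)

diff≡0⇒≡ : ∀ {n} (y x : Vec ℕ n) → diff y x ≡ zeroℤ n → y ≡ x
diff≡0⇒≡ [] [] _ = refl
diff≡0⇒≡ (b ∷ y) (a ∷ x) e =
  cong₂ _∷_ (ℤP.+-injective (ℤP.i-j≡0⇒i≡j (+ b) (+ a) (∷-injectiveˡ e))) (diff≡0⇒≡ y x (∷-injectiveʳ e))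

diff-shift : ∀ {n} (x y u v : Vec ℕ n) → x ⊕ u ≡ y ⊕ v → diff y x ≡ diff u v
diff-shift [] [] [] [] _ = refl
diff-shift (a ∷ x) (b ∷ y) (c ∷ u) (d ∷ v) e =
  cong₂ _∷_ (entry a b c d (∷-injectiveˡ e)) (diff-shift x y u v (∷-injectiveʳ e))
  where
  open ≡-Reasoning
  entry : ∀ a b c d → a + c ≡ b + d → + b ℤ.- + a ≡ + c ℤ.- + d
  entry a b c d e = begin
    + b ℤ.- + a         ≡⟨ ℤP.[+m]-[+n]≡m⊖n b a ⟩
    b ⊖ a               ≡⟨ sym (ℤP.+-cancelˡ-⊖ d b a) ⟩
    (d + b) ⊖ (d + a)   ≡⟨ cong₂ _⊖_ (trans (ℕP.+-comm d b) (sym e)) (ℕP.+-comm d a) ⟩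
    (a + c) ⊖ (a + d)   ≡⟨ ℤP.+-cancelˡ-⊖ a c d ⟩
    c ⊖ d               ≡⟨ sym (ℤP.[+m]-[+n]≡m⊖n c d) ⟩
    + c ℤ.- + d         ∎

·-diff : ∀ {d n} (B : Config d n) (p q : Vec ℤ n) → B · zipWith ℤ._-_ p q ≡ zipWith ℤ._-_ (B · p) (B · q)
·-diff {d} [] [] [] = sym (-ᵛ-self (zeroℤ d))
·-diff (c ∷ B) (a ∷ p) (b ∷ q) =
  trans (cong (zipWith ℤ._+_ (map (λ t → (a ℤ.- b) ℤ.* + t) c)) (·-diff B p q)) (column c (B · p) (B · q))
  where
  entry : ∀ a b t x y → (a ℤ.- b) ℤ.* t ℤ.+ (x ℤ.- y) ≡ (a ℤ.* t ℤ.+ x) ℤ.- (b ℤ.* t ℤ.+ y)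
  entry = ℤSolver.solve-∀
  column : ∀ {d} (c : Vec ℕ d) (X Y : Vec ℤ d) →
    zipWith ℤ._+_ (map (λ t → (a ℤ.- b) ℤ.* + t) c) (zipWith ℤ._-_ X Y)
    ≡ zipWith ℤ._-_ (zipWith ℤ._+_ (map (λ t → a ℤ.* + t) c) X) (zipWith ℤ._+_ (map (λ t → b ℤ.* + t) c) Y)
  column [] [] [] = refl
  column (t ∷ c) (x ∷ X) (y ∷ Y) = cong₂ _∷_ (entry a b (+ t) x y) (column c X Y)

diff-isMove : ∀ {d n} (B : Config d n) {x y : Vec ℕ n} → B ·ℕ y ≡ B ·ℕ x → IsMove B (diff y x)
diff-isMove {d} B {x} {y} e = begin
    B · diff y x                                   ≡⟨ ·-diff B (toℤ y) (toℤ x) ⟩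
    zipWith ℤ._-_ (B · toℤ y) (B · toℤ x)          ≡⟨ cong (λ t → zipWith ℤ._-_ t (B · toℤ x)) (·ℕ⇒· B e) ⟩
    zipWith ℤ._-_ (B · toℤ x) (B · toℤ x)          ≡⟨ -ᵛ-self (B · toℤ x) ⟩
    zeroℤ d                                        ∎
  where open ≡-Reasoning

pos-diff : ∀ b a → pos (+ b ℤ.- + a) ≡ b ∸ a
pos-diff b a with ℕP.≤-<-connex a b
... | inj₁ a≤b = cong pos (trans (ℤP.[+m]-[+n]≡m⊖n b a) (ℤP.⊖-≥ a≤b))
... | inj₂ b<a = trans (cong pos (trans (ℤP.[+m]-[+n]≡m⊖n b a) (ℤP.⊖-< b<a)))
                       (negative (a ∸ b) (ℕP.m>n⇒m∸n≢0 b<a))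
  where
  negative : ∀ k → k ≢ 0 → pos (ℤ.- (+ k)) ≡ b ∸ a
  negative zero k≢0 = ⊥-elim (k≢0 refl)
  negative (suc k) _ = sym (ℕP.m≤n⇒m∸n≡0 (ℕP.<⇒≤ b<a))

deg-diff : ∀ {n} (y x : Vec ℕ n) → deg (diff y x) ≡ sum (zipWith _∸_ y x)
deg-diff [] [] = refl
deg-diff (b ∷ y) (a ∷ x) = cong₂ _+_ (pos-diff b a) (deg-diff y x)

deg-diff≤ : ∀ {n} (y x : Vec ℕ n) → deg (diff y x) ≤ sum y
deg-diff≤ y x = subst (_≤ sum y) (sym (deg-diff y x)) (sum-∸≤ y x)
  where
  sum-∸≤ : ∀ {n} (u v : Vec ℕ n) → sum (zipWith _∸_ u v) ≤ sum u
  sum-∸≤ [] [] = z≤n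
  sum-∸≤ (a ∷ u) (b ∷ v) = ℕP.+-mono-≤ (ℕP.m∸n≤m a b) (sum-∸≤ u v)

forward : ∀ {d n} (B : Config d n) {b'} (M : Vec ℤ n → Set) {x y : Vec ℕ n} →
  B · toℤ x ≡ b' → B ·ℕ y ≡ B ·ℕ x → M (diff y x) → Step B b' M x y
forward B M hx e m = hx , trans (·ℕ⇒· B e) hx , inj₁ m

Star-Step-mono : ∀ {d n} {B : Config d n} {b'} {M M' : Vec ℤ n → Set} → (∀ z → M z → M' z) →
  ∀ {x y} → Star (Step B b' M) x y → Star (Step B b' M') x y
Star-Step-mono M⊆M' = gmap (λ x → x) λ where
  (hx , hy , inj₁ m) → hx , hy , inj₁ (M⊆M' _ m)
  (hx , hy , inj₂ m) → hx , hy , inj₂ (M⊆M' _ m)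

stuck : ∀ {d n} (B : Config d n) b' M → (∀ {x y} → Step B b' M x y → x ≡ y) →
  ∀ {x y} → Star (Step B b' M) x y → x ≡ y
stuck B b' M trivial ε = refl
stuck B b' M trivial (s ◅ path) = trans (trivial s) (stuck B b' M trivial path)

zero-move-step : ∀ {d n} (B : Config d n) b' M → (∀ z → M z → z ≡ zeroℤ n) →
  ∀ {x y} → Step B b' M x y → x ≡ y
zero-move-step B b' M zero-only {x} {y} (_ , _ , inj₁ m) = sym (diff≡0⇒≡ y x (zero-only _ m))
zero-move-step B b' M zero-only {x} {y} (_ , _ , inj₂ m) = diff≡0⇒≡ x y (zero-only _ m)

sum-⊕ : ∀ {n} (u v : Vec ℕ n) → sum (u ⊕ v) ≡ sum u + sum v
sum-⊕ [] [] = refl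
sum-⊕ (a ∷ u) (b ∷ v) = trans (cong (λ t → a + b + t) (sum-⊕ u v)) (shuffle a b (sum u) (sum v))
  where
  shuffle : ∀ a b c d → a + b + (c + d) ≡ a + c + (b + d)
  shuffle = ℕSolver.solve-∀

sum-⊙ : ∀ {n} a (v : Vec ℕ n) → sum (a ⊙ v) ≡ a * sum v
sum-⊙ a [] = sym (ℕP.*-zeroʳ a)
sum-⊙ a (x ∷ v) = trans (cong (λ t → a * x + t) (sum-⊙ a v)) (sym (ℕP.*-distribˡ-+ a x (sum v)))

sum-0ᵛ : ∀ n → sum (0ᵛ n) ≡ 0
sum-0ᵛ zero = refl
sum-0ᵛ (suc n) = sum-0ᵛ n

homogeneous : ∀ {d n} (B : Config d n) h T → (∀ i → h * sum (lookup B i) ≡ T) →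
  ∀ x → h * sum (B ·ℕ x) ≡ T * sum x
homogeneous {d} [] h T _ [] = trans (cong (h *_) (sum-0ᵛ d)) (trans (ℕP.*-zeroʳ h) (sym (ℕP.*-zeroʳ T)))
homogeneous (c ∷ B) h T cols (z ∷ x) = begin
    h * sum (z ⊙ c ⊕ B ·ℕ x)
  ≡⟨ cong (h *_) (trans (sum-⊕ (z ⊙ c) (B ·ℕ x)) (cong (λ t → t + sum (B ·ℕ x)) (sum-⊙ z c))) ⟩
    h * (z * sum c + sum (B ·ℕ x))
  ≡⟨ distribute h z (sum c) (sum (B ·ℕ x)) ⟩
    z * (h * sum c) + h * sum (B ·ℕ x)
  ≡⟨ cong₂ (λ s t → z * s + t) (cols zero) (homogeneous B h T (λ i → cols (suc i)) x) ⟩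
    z * T + T * sum x
  ≡⟨ collect z T (sum x) ⟩
    T * (z + sum x) ∎
  where
  open ≡-Reasoning
  distribute : ∀ h a b c → h * (a * b + c) ≡ a * (h * b) + h * c
  distribute = ℕSolver.solve-∀
  collect : ∀ a b c → a * b + b * c ≡ b * (a + c)
  collect = ℕSolver.solve-∀

Table : ℕ → ℕ → Set
Table n N = Vec (Vec ℕ n) N

total : ∀ {n N} → Table n N → Vec ℕ n
total {n} [] = 0ᵛ n
total (r ∷ X) = r ⊕ total X

SameImages : ∀ {d n N} → Config d n → Table n N → Table n N → Set
SameImages A = Pointwise (λ p q → A ·ℕ p ≡ A ·ℕ q)

data Replaced {n} : ∀ {N} → Table n N → Table n N → Vec ℕ n → Vec ℕ n → Set where
  here  : ∀ {N r r'} {X : Table n N} → Replaced (r ∷ X) (r' ∷ X) r r'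
  there : ∀ {N r r' s} {X X' : Table n N} → Replaced X X' r r' → Replaced (s ∷ X) (s ∷ X') r r'

data SwapStep {d n} (A : Config d n) : ∀ {N} → Table n N → Table n N → Set where
  swap  : ∀ {N p p' r r'} {X X' : Table n N} → A ·ℕ p' ≡ A ·ℕ p → A ·ℕ r' ≡ A ·ℕ r →
          p' ⊕ r' ≡ p ⊕ r → Replaced X X' r r' → SwapStep A (p ∷ X) (p' ∷ X')
  later : ∀ {N p} {X X' : Table n N} → SwapStep A X X' → SwapStep A (p ∷ X) (p ∷ X')

SwapConnected : ∀ {d n} → Config d n → Set
SwapConnected {n = n} A =
  ∀ N (X Y : Table n N) → SameImages A X Y → total X ≡ total Y → Star (SwapStep A) X Y

⊕-assoc : ∀ {n} (u v w : Vec ℕ n) → (u ⊕ v) ⊕ w ≡ u ⊕ (v ⊕ w)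
⊕-assoc = zipWith-assoc ℕP.+-assoc

replaced-total : ∀ {n N r r'} {X X' : Table n N} → Replaced X X' r r' → total X ⊕ r' ≡ total X' ⊕ r
replaced-total {r = r} {r'} {X = _ ∷ X} here =
  solve 3 (λ r r' t → (r ∙ t) ∙ r' ⊜ (r' ∙ t) ∙ r) refl r r' (total X)
  where open ⊕-Solver
replaced-total {r = r} {r'} {X = s ∷ X} {s ∷ X'} (there rep) = begin
    (s ⊕ total X) ⊕ r'    ≡⟨ ⊕-assoc s (total X) r' ⟩
    s ⊕ (total X ⊕ r')    ≡⟨ cong (s ⊕_) (replaced-total rep) ⟩
    s ⊕ (total X' ⊕ r)    ≡⟨ sym (⊕-assoc s (total X') r) ⟩
    (s ⊕ total X') ⊕ r    ∎
  where open ≡-Reasoning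

swap-total : ∀ {d n N} {A : Config d n} {X X' : Table n N} → SwapStep A X X' → total X' ≡ total X
swap-total {X = p ∷ X} {p' ∷ X'} (swap {r = r} {r'} _ _ sums rep) = ⊕-cancelʳ _ _ r (begin
    (p' ⊕ total X') ⊕ r    ≡⟨ ⊕-assoc p' (total X') r ⟩
    p' ⊕ (total X' ⊕ r)    ≡⟨ cong (p' ⊕_) (sym (replaced-total rep)) ⟩
    p' ⊕ (total X ⊕ r')    ≡⟨ solve 3 (λ p' t r' → p' ∙ (t ∙ r') ⊜ (p' ∙ r') ∙ t) refl p' (total X) r' ⟩
    (p' ⊕ r') ⊕ total X    ≡⟨ cong (_⊕ total X) sums ⟩
    (p ⊕ r) ⊕ total X      ≡⟨ solve 3 (λ p r t → (p ∙ r) ∙ t ⊜ (p ∙ t) ∙ r) refl p r (total X) ⟩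
    (p ⊕ total X) ⊕ r      ∎)
  where open ≡-Reasoning
        open ⊕-Solver
swap-total {X = p ∷ X} (later st) = cong (p ⊕_) (swap-total st)

replaced-images : ∀ {d n N r r'} (A : Config d n) {X X' : Table n N} → Replaced X X' r r' →
  A ·ℕ r' ≡ A ·ℕ r → map (A ·ℕ_) X' ≡ map (A ·ℕ_) X
replaced-images A here e = cong₂ _∷_ e refl
replaced-images A (there rep) e = cong (_ ∷_) (replaced-images A rep e)

swap-images : ∀ {d n N} {A : Config d n} {X X' : Table n N} → SwapStep A X X' → map (A ·ℕ_) X' ≡ map (A ·ℕ_) X
swap-images {A = A} (swap ep er _ rep) = cong₂ _∷_ ep (replaced-images A rep er)
swap-images (later st) = cong (_ ∷_) (swap-images st)

<-of-sums : ∀ {a b c d} → a + b < c + d → c ≤ a → b < d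
<-of-sums {a} {b} {c} {d} h c≤a with d ℕP.≤? b
... | no d≰b = ℕP.≰⇒> d≰b
... | yes d≤b = ⊥-elim (ℕP.<⇒≱ h (ℕP.+-mono-≤ c≤a d≤b))

balanced-< : ∀ {x y u v} → x + y ≡ u + v → u < x → y < v
balanced-< {x} {y} {u} {v} e u<x = <-of-sums (subst (u + y <_) e (ℕP.+-monoˡ-< y u<x)) ℕP.≤-refl

record ExcessRow {d n N} (A : Config d n) (c : Fin n) (X Y : Table n N) : Set where
  field
    r s       : Vec ℕ n
    exceeds   : lookup s c < lookup r c
    sameImage : A ·ℕ r ≡ A ·ℕ s
    replace   : ∀ r' → A ·ℕ r' ≡ A ·ℕ r → Σ (Table n N) λ X' → Replaced X X' r r' × SameImages A X' Y

lookup-total : ∀ {n N} (r : Vec ℕ n) (X : Table n N) c → lookup (total (r ∷ X)) c ≡ lookup r c + lookup (total X) c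
lookup-total r X c = lookup-zipWith _+_ c r (total X)

findExcess : ∀ {d n N} (A : Config d n) c {X Y : Table n N} → SameImages A X Y →
  lookup (total Y) c < lookup (total X) c → ExcessRow A c X Y
findExcess A c {[]} {[]} [] h = ⊥-elim (ℕP.<-irrefl refl h)
findExcess A c {r ∷ X} {s ∷ Y} (e ∷ es) h with lookup s c ℕP.<? lookup r c
... | yes s<r = record
  { r = r ; s = s ; exceeds = s<r ; sameImage = e
  ; replace = λ r' e' → (r' ∷ X) , here , (trans e' e ∷ es) }
... | no s≮r = record
  { r = ER.r ; s = ER.s ; exceeds = ER.exceeds ; sameImage = ER.sameImage
  ; replace = λ r' e' → let (X' , rep , es') = ER.replace r' e' in (r ∷ X') , there rep , (e ∷ es') }
  where
  tail-exceeds : lookup (total Y) c < lookup (total X) c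
  tail-exceeds = <-of-sums (subst₂ _<_ (lookup-total s Y c) (lookup-total r X c) h) (ℕP.≮⇒≥ s≮r)
  module ER = ExcessRow (findExcess A c es tail-exceeds)

-- The columns of A-K4 are the edges 01, 02, 03, 12, 13, 23 of K₄, so a point p ∈ ℕ⁶ is a
-- multigraph on K₄ and A p is its degree sequence.
Row : Set
Row = Vec ℕ 6

degrees : Row → Vec ℕ 4
degrees (a ∷ b ∷ c ∷ d ∷ e ∷ f ∷ []) = (a + b + c) ∷ (a + d + e) ∷ (b + d + f) ∷ (c + e + f) ∷ []

image-degrees : ∀ p → A-K4 ·ℕ p ≡ degrees p
image-degrees (a ∷ b ∷ c ∷ d ∷ e ∷ f ∷ []) =
  cong₂ _∷_ (deg₀ a b c d e f) (cong₂ _∷_ (deg₁ a b c d e f)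
  (cong₂ _∷_ (deg₂ a b c d e f) (cong₂ _∷_ (deg₃ a b c d e f) refl)))
  where
  deg₀ : ∀ a b c d e f → a * 1 + (b * 1 + (c * 1 + (d * 0 + (e * 0 + (f * 0 + 0))))) ≡ a + b + c
  deg₀ = ℕSolver.solve-∀
  deg₁ : ∀ a b c d e f → a * 1 + (b * 0 + (c * 0 + (d * 1 + (e * 1 + (f * 0 + 0))))) ≡ a + d + e
  deg₁ = ℕSolver.solve-∀
  deg₂ : ∀ a b c d e f → a * 0 + (b * 1 + (c * 0 + (d * 1 + (e * 0 + (f * 1 + 0))))) ≡ b + d + f
  deg₂ = ℕSolver.solve-∀
  deg₃ : ∀ a b c d e f → a * 0 + (b * 0 + (c * 1 + (d * 0 + (e * 1 + (f * 1 + 0))))) ≡ c + e + f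
  deg₃ = ℕSolver.solve-∀

-- Every edge has two endpoints: |A p| = 2|p|.
sum-image : ∀ p → sum (A-K4 ·ℕ p) ≡ 2 * sum p
sum-image p@(a ∷ b ∷ c ∷ d ∷ e ∷ f ∷ []) = trans (cong sum (image-degrees p)) (handshake a b c d e f)
  where
  handshake : ∀ a b c d e f →
    a + b + c + (a + d + e + (b + d + f + (c + e + f + 0))) ≡ 2 * (a + (b + (c + (d + (e + (f + 0))))))
  handshake = ℕSolver.solve-∀

same-degrees : ∀ p q → A-K4 ·ℕ p ≡ A-K4 ·ℕ q → degrees p ≡ degrees q
same-degrees p q e = trans (sym (image-degrees p)) (trans e (image-degrees q))

-- The three perfect matchings {01,23}, {02,13}, {03,12} of K₄.  ι i is the edge of matching i
-- at vertex 0 and κ i the opposite edge.  All matchings have degree sequence (1,1,1,1).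
matching : Fin 3 → Row
matching zero             = 1 ∷ 0 ∷ 0 ∷ 0 ∷ 0 ∷ 1 ∷ []
matching (suc zero)       = 0 ∷ 1 ∷ 0 ∷ 0 ∷ 1 ∷ 0 ∷ []
matching (suc (suc zero)) = 0 ∷ 0 ∷ 1 ∷ 1 ∷ 0 ∷ 0 ∷ []

ι κ : Fin 3 → Fin 6
ι zero             = zero
ι (suc zero)       = suc zero
ι (suc (suc zero)) = suc (suc zero)
κ zero             = suc (suc (suc (suc (suc zero))))
κ (suc zero)       = suc (suc (suc (suc zero)))
κ (suc (suc zero)) = suc (suc (suc zero))

matching-image : ∀ i → A-K4 ·ℕ matching i ≡ 1 ∷ 1 ∷ 1 ∷ 1 ∷ []
matching-image zero             = refl
matching-image (suc zero)       = refl
matching-image (suc (suc zero)) = refl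

exchange-matching : ∀ i j base → A-K4 ·ℕ (matching j ⊕ base) ≡ A-K4 ·ℕ (matching i ⊕ base)
exchange-matching i j base = begin
    A-K4 ·ℕ (matching j ⊕ base)
  ≡⟨ ·ℕ-⊕ A-K4 (matching j) base ⟩
    A-K4 ·ℕ matching j ⊕ A-K4 ·ℕ base
  ≡⟨ cong (_⊕ A-K4 ·ℕ base) (trans (matching-image j) (sym (matching-image i))) ⟩
    A-K4 ·ℕ matching i ⊕ A-K4 ·ℕ base
  ≡⟨ sym (·ℕ-⊕ A-K4 (matching i) base) ⟩
    A-K4 ·ℕ (matching i ⊕ base) ∎
  where open ≡-Reasoning

contains-matching : ∀ i p → 1 ≤ lookup p (ι i) → 1 ≤ lookup p (κ i) → Σ Row λ base → p ≡ matching i ⊕ base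
contains-matching zero (suc a ∷ b ∷ c ∷ d ∷ e ∷ suc f ∷ []) _ _ = (a ∷ b ∷ c ∷ d ∷ e ∷ f ∷ []) , refl
contains-matching zero (zero ∷ _) () _
contains-matching zero (suc a ∷ b ∷ c ∷ d ∷ e ∷ zero ∷ []) _ ()
contains-matching (suc zero) (a ∷ suc b ∷ c ∷ d ∷ suc e ∷ f ∷ []) _ _ = (a ∷ b ∷ c ∷ d ∷ e ∷ f ∷ []) , refl
contains-matching (suc zero) (a ∷ zero ∷ _) () _
contains-matching (suc zero) (a ∷ suc b ∷ c ∷ d ∷ zero ∷ f ∷ []) _ ()
contains-matching (suc (suc zero)) (a ∷ b ∷ suc c ∷ suc d ∷ e ∷ f ∷ []) _ _ = (a ∷ b ∷ c ∷ d ∷ e ∷ f ∷ []) , refl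
contains-matching (suc (suc zero)) (a ∷ b ∷ zero ∷ _) () _
contains-matching (suc (suc zero)) (a ∷ b ∷ suc c ∷ zero ∷ e ∷ f ∷ []) _ ()

ιEnds κEnds : Fin 3 → Vec ℕ 4 → ℕ
ιEnds zero             (d₀ ∷ d₁ ∷ d₂ ∷ d₃ ∷ []) = d₀ + d₁
ιEnds (suc zero)       (d₀ ∷ d₁ ∷ d₂ ∷ d₃ ∷ []) = d₀ + d₂
ιEnds (suc (suc zero)) (d₀ ∷ d₁ ∷ d₂ ∷ d₃ ∷ []) = d₀ + d₃
κEnds zero             (d₀ ∷ d₁ ∷ d₂ ∷ d₃ ∷ []) = d₂ + d₃
κEnds (suc zero)       (d₀ ∷ d₁ ∷ d₂ ∷ d₃ ∷ []) = d₁ + d₃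
κEnds (suc (suc zero)) (d₀ ∷ d₁ ∷ d₂ ∷ d₃ ∷ []) = d₁ + d₂

-- Both endpoint pairs see the four edges joining them once each, and their own edge twice.
ends-identity : ∀ i p → ιEnds i (degrees p) + 2 * lookup p (κ i) ≡ κEnds i (degrees p) + 2 * lookup p (ι i)
ends-identity zero (a ∷ b ∷ c ∷ d ∷ e ∷ f ∷ []) = identity a b c d e f
  where
  identity : ∀ a b c d e f → a + b + c + (a + d + e) + 2 * f ≡ b + d + f + (c + e + f) + 2 * a
  identity = ℕSolver.solve-∀
ends-identity (suc zero) (a ∷ b ∷ c ∷ d ∷ e ∷ f ∷ []) = identity a b c d e f
  where
  identity : ∀ a b c d e f → a + b + c + (b + d + f) + 2 * e ≡ a + d + e + (c + e + f) + 2 * b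
  identity = ℕSolver.solve-∀
ends-identity (suc (suc zero)) (a ∷ b ∷ c ∷ d ∷ e ∷ f ∷ []) = identity a b c d e f
  where
  identity : ∀ a b c d e f → a + b + c + (c + e + f) + 2 * d ≡ a + d + e + (b + d + f) + 2 * c
  identity = ℕSolver.solve-∀

ends-transfer : ∀ {L R x y x' y'} → L + 2 * x ≡ R + 2 * y → L + 2 * x' ≡ R + 2 * y' → y + x' ≡ y' + x
ends-transfer {L} {R} {x} {y} {x'} {y'} e e' =
  ℕP.*-cancelˡ-≡ (y + x') (y' + x) 2 (ℕP.+-cancelʳ-≡ (L + R) _ _ (begin
    2 * (y + x') + (L + R)       ≡⟨ regroup y x' L R ⟩
    (R + 2 * y) + (L + 2 * x')   ≡⟨ cong₂ _+_ (sym e) e' ⟩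
    (L + 2 * x) + (R + 2 * y')   ≡⟨ sym (regroup' y' x L R) ⟩
    2 * (y' + x) + (L + R)       ∎))
  where
  open ≡-Reasoning
  regroup : ∀ y x' L R → 2 * (y + x') + (L + R) ≡ (R + 2 * y) + (L + 2 * x')
  regroup = ℕSolver.solve-∀
  regroup' : ∀ y' x L R → 2 * (y' + x) + (L + R) ≡ (L + 2 * x) + (R + 2 * y')
  regroup' = ℕSolver.solve-∀

balance : ∀ p q → A-K4 ·ℕ p ≡ A-K4 ·ℕ q →
  ∀ i → lookup p (ι i) + lookup q (κ i) ≡ lookup q (ι i) + lookup p (κ i)
balance p q e i =
  ends-transfer {ιEnds i (degrees p)} {κEnds i (degrees p)} {lookup p (κ i)} {lookup p (ι i)} (ends-identity i p)
    (subst (λ t → ιEnds i t + 2 * lookup q (κ i) ≡ κEnds i t + 2 * lookup q (ι i))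
           (sym (same-degrees p q e)) (ends-identity i q))

heavier-κ : ∀ p q → A-K4 ·ℕ p ≡ A-K4 ·ℕ q →
  ∀ i → lookup q (ι i) < lookup p (ι i) → lookup q (κ i) < lookup p (κ i)
heavier-κ p q e i = balanced-< (balance p q e i)

≤-sum-equal : ∀ {x y u v} → x ≤ u → y ≤ v → x + y ≡ u + v → x ≡ u × y ≡ v
≤-sum-equal {x} {y} {u} {v} x≤u y≤v e = x≡u , ℕP.+-cancelˡ-≡ x y v (trans e (cong (_+ v) (sym x≡u)))
  where
  x≡u = ℕP.≤-antisym x≤u (ℕP.+-cancelʳ-≤ v u x (ℕP.≤-trans (ℕP.≤-reflexive (sym e)) (ℕP.+-monoʳ-≤ x y≤v)))

-- Distinct multigraphs with equal degrees: p is heavier than q on the ι-edge of some matching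
-- (otherwise they agree at vertex 0, hence everywhere by `balance`).
heavier : ∀ p q → A-K4 ·ℕ p ≡ A-K4 ·ℕ q → p ≢ q → Σ (Fin 3) λ i → lookup q (ι i) < lookup p (ι i)
heavier p@(a₀ ∷ a₁ ∷ a₂ ∷ a₃ ∷ a₄ ∷ a₅ ∷ []) q@(b₀ ∷ b₁ ∷ b₂ ∷ b₃ ∷ b₄ ∷ b₅ ∷ []) e p≢q
  with b₀ ℕP.<? a₀ | b₁ ℕP.<? a₁ | b₂ ℕP.<? a₂
... | yes l | _     | _     = zero , l
... | no _  | yes l | _     = suc zero , l
... | no _  | no _  | yes l = suc (suc zero) , l
... | no n₀ | no n₁ | no n₂ = ⊥-elim (p≢q p≡q)
  where
  vertex0 = ≤-sum-equal (ℕP.+-mono-≤ (ℕP.≮⇒≥ n₀) (ℕP.≮⇒≥ n₁)) (ℕP.≮⇒≥ n₂)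
                        (∷-injectiveˡ (same-degrees p q e))
  e₀₁ = ≤-sum-equal (ℕP.≮⇒≥ n₀) (ℕP.≮⇒≥ n₁) (proj₁ vertex0)
  e₀ = proj₁ e₀₁
  e₁ = proj₂ e₀₁
  e₂ = proj₂ vertex0
  opposite : ∀ {x y u v} → x + y ≡ u + v → x ≡ u → v ≡ y
  opposite {x} e x≡u = sym (ℕP.+-cancelˡ-≡ x _ _ (trans e (cong (_+ _) (sym x≡u))))
  e₃ = opposite (balance p q e (suc (suc zero))) e₂
  e₄ = opposite (balance p q e (suc zero)) e₁
  e₅ = opposite (balance p q e zero) e₀
  p≡q : p ≡ q
  p≡q = cong₂ _∷_ e₀ (cong₂ _∷_ e₁ (cong₂ _∷_ e₂ (cong₂ _∷_ e₃ (cong₂ _∷_ e₄ (cong₂ _∷_ e₅ refl)))))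

-- ℓ¹-distance of two multigraphs on the edges at vertex 0 (by `balance`, it vanishes only if p = q).
dist₀ : Row → Row → ℕ
dist₀ (a ∷ b ∷ c ∷ _) (x ∷ y ∷ z ∷ _) = ∣ a - x ∣ + ∣ b - y ∣ + ∣ c - z ∣

∣1+m-n∣ : ∀ {m n} → n ≤ m → ∣ suc m - n ∣ ≡ suc ∣ m - n ∣
∣1+m-n∣ {zero} {zero} _ = refl
∣1+m-n∣ {suc m} {zero} _ = refl
∣1+m-n∣ {suc m} {suc n} (s≤s n≤m) = ∣1+m-n∣ n≤m

∣m-n∣≡1+∣1+m-n∣ : ∀ {m n} → m < n → ∣ m - n ∣ ≡ suc ∣ suc m - n ∣
∣m-n∣≡1+∣1+m-n∣ {zero} {suc n} _ = refl
∣m-n∣≡1+∣1+m-n∣ {suc m} {suc n} (s≤s m<n) = ∣m-n∣≡1+∣1+m-n∣ m<n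

two₀₁ : ∀ a b c → suc a + suc b + c ≡ 2 + (a + b + c)
two₀₁ = ℕSolver.solve-∀

two₀₂ : ∀ a b c → suc a + b + suc c ≡ 2 + (a + b + c)
two₀₂ = ℕSolver.solve-∀

two₁₂ : ∀ a b c → a + suc b + suc c ≡ 2 + (a + b + c)
two₁₂ = ℕSolver.solve-∀

dist₀-exchange : ∀ base q i j → lookup q (ι i) < lookup (matching i ⊕ base) (ι i) →
  lookup (matching i ⊕ base) (ι j) < lookup q (ι j) →
  dist₀ (matching i ⊕ base) q ≡ 2 + dist₀ (matching j ⊕ base) q
dist₀-exchange _ _ zero zero h h' = ⊥-elim (ℕP.<-asym h h')
dist₀-exchange _ _ (suc zero) (suc zero) h h' = ⊥-elim (ℕP.<-asym h h')
dist₀-exchange _ _ (suc (suc zero)) (suc (suc zero)) h h' = ⊥-elim (ℕP.<-asym h h')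
dist₀-exchange (b₀ ∷ b₁ ∷ b₂ ∷ _) (q₀ ∷ q₁ ∷ q₂ ∷ _) zero (suc zero) h h' =
  trans (cong₂ (λ s t → s + t + ∣ b₂ - q₂ ∣) (∣1+m-n∣ (ℕP.<⇒≤pred h)) (∣m-n∣≡1+∣1+m-n∣ h'))
        (two₀₁ ∣ b₀ - q₀ ∣ ∣ suc b₁ - q₁ ∣ ∣ b₂ - q₂ ∣)
dist₀-exchange (b₀ ∷ b₁ ∷ b₂ ∷ _) (q₀ ∷ q₁ ∷ q₂ ∷ _) zero (suc (suc zero)) h h' =
  trans (cong₂ (λ s t → s + ∣ b₁ - q₁ ∣ + t) (∣1+m-n∣ (ℕP.<⇒≤pred h)) (∣m-n∣≡1+∣1+m-n∣ h'))
        (two₀₂ ∣ b₀ - q₀ ∣ ∣ b₁ - q₁ ∣ ∣ suc b₂ - q₂ ∣)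
dist₀-exchange (b₀ ∷ b₁ ∷ b₂ ∷ _) (q₀ ∷ q₁ ∷ q₂ ∷ _) (suc zero) zero h h' =
  trans (cong₂ (λ s t → t + s + ∣ b₂ - q₂ ∣) (∣1+m-n∣ (ℕP.<⇒≤pred h)) (∣m-n∣≡1+∣1+m-n∣ h'))
        (two₀₁ ∣ suc b₀ - q₀ ∣ ∣ b₁ - q₁ ∣ ∣ b₂ - q₂ ∣)
dist₀-exchange (b₀ ∷ b₁ ∷ b₂ ∷ _) (q₀ ∷ q₁ ∷ q₂ ∷ _) (suc zero) (suc (suc zero)) h h' =
  trans (cong₂ (λ s t → ∣ b₀ - q₀ ∣ + s + t) (∣1+m-n∣ (ℕP.<⇒≤pred h)) (∣m-n∣≡1+∣1+m-n∣ h'))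
        (two₁₂ ∣ b₀ - q₀ ∣ ∣ b₁ - q₁ ∣ ∣ suc b₂ - q₂ ∣)
dist₀-exchange (b₀ ∷ b₁ ∷ b₂ ∷ _) (q₀ ∷ q₁ ∷ q₂ ∷ _) (suc (suc zero)) zero h h' =
  trans (cong₂ (λ s t → t + ∣ b₁ - q₁ ∣ + s) (∣1+m-n∣ (ℕP.<⇒≤pred h)) (∣m-n∣≡1+∣1+m-n∣ h'))
        (two₀₂ ∣ suc b₀ - q₀ ∣ ∣ b₁ - q₁ ∣ ∣ b₂ - q₂ ∣)
dist₀-exchange (b₀ ∷ b₁ ∷ b₂ ∷ _) (q₀ ∷ q₁ ∷ q₂ ∷ _) (suc (suc zero)) (suc zero) h h' =
  trans (cong₂ (λ s t → ∣ b₀ - q₀ ∣ + t + s) (∣1+m-n∣ (ℕP.<⇒≤pred h)) (∣m-n∣≡1+∣1+m-n∣ h'))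
        (two₁₂ ∣ b₀ - q₀ ∣ ∣ suc b₁ - q₁ ∣ ∣ b₂ - q₂ ∣)

-- Then p exceeds q on both edges of some matching i, and falls short of q at
-- some ι j; as the totals agree, some row r of X exceeds its partner at ι j and so contains
-- matching j.  Trading matching i of p for matching j of r brings p two units closer to q.
record Improvement {N} (p q : Row) (X Y : Table 6 N) : Set where
  field
    p'     : Row
    X'     : Table 6 N
    step   : SwapStep A-K4 (p ∷ X) (p' ∷ X')
    image  : A-K4 ·ℕ p' ≡ A-K4 ·ℕ q
    images : SameImages A-K4 X' Y
    closer : dist₀ p q ≡ 2 + dist₀ p' q

<⇒positive : ∀ {a b} → a < b → 1 ≤ b
<⇒positive a<b = ℕP.≤-trans (s≤s z≤n) a<b

improve : ∀ {N} p q (X Y : Table 6 N) → A-K4 ·ℕ p ≡ A-K4 ·ℕ q → SameImages A-K4 X Y →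
  total (p ∷ X) ≡ total (q ∷ Y) → p ≢ q → Improvement p q X Y
improve p q X Y e es tot p≢q = record
  { p' = p' ; X' = X' ; step = swap image-p' image-r' sums rep
  ; image = trans image-p' e ; images = es' ; closer = closer }
  where
  i = proj₁ (heavier p q e p≢q)
  p>q = proj₂ (heavier p q e p≢q)
  j = proj₁ (heavier q p (sym e) (λ q≡p → p≢q (sym q≡p)))
  q>p = proj₂ (heavier q p (sym e) (λ q≡p → p≢q (sym q≡p)))
  p-split = contains-matching i p (<⇒positive p>q) (<⇒positive (heavier-κ p q e i p>q))
  base = proj₁ p-split
  excess : lookup (total Y) (ι j) < lookup (total X) (ι j)
  excess = balanced-< (trans (sym (lookup-total q Y (ι j)))
                      (trans (cong (λ t → lookup t (ι j)) (sym tot)) (lookup-total p X (ι j)))) q>p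
  module R = ExcessRow (findExcess A-K4 (ι j) es excess)
  r-split = contains-matching j R.r (<⇒positive R.exceeds) (<⇒positive (heavier-κ R.r R.s R.sameImage j R.exceeds))
  rbase = proj₁ r-split
  p' = matching j ⊕ base
  r' = matching i ⊕ rbase
  image-p' : A-K4 ·ℕ p' ≡ A-K4 ·ℕ p
  image-p' = trans (exchange-matching i j base) (cong (A-K4 ·ℕ_) (sym (proj₂ p-split)))
  image-r' : A-K4 ·ℕ r' ≡ A-K4 ·ℕ R.r
  image-r' = trans (exchange-matching j i rbase) (cong (A-K4 ·ℕ_) (sym (proj₂ r-split)))
  replaced = R.replace r' image-r'
  X' = proj₁ replaced
  rep = proj₁ (proj₂ replaced)
  es' = proj₂ (proj₂ replaced)
  sums : p' ⊕ r' ≡ p ⊕ R.r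
  sums = trans (solve 4 (λ mi mj b b' → (mj ∙ b) ∙ (mi ∙ b') ⊜ (mi ∙ b) ∙ (mj ∙ b')) refl
                  (matching i) (matching j) base rbase)
               (sym (cong₂ _⊕_ (proj₂ p-split) (proj₂ r-split)))
    where open ⊕-Solver
  closer : dist₀ p q ≡ 2 + dist₀ p' q
  closer = trans (cong (λ t → dist₀ t q) (proj₂ p-split))
    (dist₀-exchange base q i j (subst (λ t → lookup q (ι i) < lookup t (ι i)) (proj₂ p-split) p>q)
                               (subst (λ t → lookup t (ι j) < lookup q (ι j)) (proj₂ p-split) q>p))

-- The incidence matrix of K₄ is swap-connected: fix the first row by improving swaps
-- (at most dist₀/2 of them), then recurse on the remaining rows.
swapConnected-K4 : SwapConnected A-K4
swapConnected-K4 zero [] [] [] _ = ε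
swapConnected-K4 (suc N) (p₀ ∷ X₀) (q ∷ Y) (e₀ ∷ es₀) tot₀ =
  align (suc (dist₀ p₀ q)) p₀ X₀ ℕP.≤-refl e₀ es₀ tot₀
  where
  align : ∀ F p X → dist₀ p q < F → A-K4 ·ℕ p ≡ A-K4 ·ℕ q → SameImages A-K4 X Y →
    total (p ∷ X) ≡ total (q ∷ Y) → Star (SwapStep A-K4) (p ∷ X) (q ∷ Y)
  align (suc F) p X bound e es tot with ≡-dec ℕP._≟_ p q
  ... | yes refl = gmap (p ∷_) later (swapConnected-K4 N X Y es (⊕-cancelˡ p _ _ tot))
  ... | no p≢q = I.step ◅ align F I.p' I.X' bound' I.image I.images (trans (swap-total I.step) tot)
    where
    module I = Improvement (improve p q X Y e es tot p≢q)
    bound' : dist₀ I.p' q < F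
    bound' = ℕP.<⇒≤ (ℕP.≤-pred (subst (_< suc F) I.closer bound))

infixl 6 _⊞_
_⊞_ : ∀ {n} → Vec ℤ n → Vec ℤ n → Vec ℤ n
_⊞_ = zipWith ℤ._+_

⊞-identityˡ : ∀ {n} (u : Vec ℤ n) → zeroℤ n ⊞ u ≡ u
⊞-identityˡ = zipWith-identityˡ ℤP.+-identityˡ

⊞-identityʳ : ∀ {n} (u : Vec ℤ n) → u ⊞ zeroℤ n ≡ u
⊞-identityʳ = zipWith-identityʳ ℤP.+-identityʳ

·-++ : ∀ {d n m} (B : Config d n) (B' : Config d m) (u : Vec ℤ n) (u' : Vec ℤ m) →
  (B ++ B') · (u ++ u') ≡ B · u ⊞ B' · u'
·-++ [] B' [] u' = sym (⊞-identityˡ _)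
·-++ (c ∷ B) B' (z ∷ u) u' =
  trans (cong (zipWith ℤ._+_ (map (λ a → z ℤ.* + a) c)) (·-++ B B' u u'))
        (sym (zipWith-assoc ℤP.+-assoc (map (λ a → z ℤ.* + a) c) (B · u) (B' · u')))

replicate-++ : ∀ {A : Set} (x : A) a b → replicate a x ++ replicate b x ≡ replicate (a + b) x
replicate-++ x zero b = refl
replicate-++ x (suc a) b = cong (x ∷_) (replicate-++ x a b)

·-rows : ∀ {d d' n} (F : Config d n) (G : Config d' n) (u : Vec ℤ n) →
  zipWith _++_ F G · u ≡ (F · u) ++ (G · u)
·-rows {d} {d'} [] [] [] = sym (replicate-++ (+ 0) d d')
·-rows (f ∷ F) (g ∷ G) (z ∷ u) = begin
    zipWith ℤ._+_ (map h (f ++ g)) (zipWith _++_ F G · u)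
  ≡⟨ cong₂ (zipWith ℤ._+_) (map-++ h f g) (·-rows F G u) ⟩
    zipWith ℤ._+_ (map h f ++ map h g) ((F · u) ++ (G · u))
  ≡⟨ zipWith-++ ℤ._+_ (map h f) (map h g) (F · u) (G · u) ⟩
    (f ∷ F) · (z ∷ u) ++ (g ∷ G) · (z ∷ u) ∎
  where
  open ≡-Reasoning
  h = λ a → z ℤ.* + a

zero-columns-· : ∀ {d n} (u : Vec ℤ n) → replicate n (0ᵛ d) · u ≡ zeroℤ d
zero-columns-· [] = refl
zero-columns-· {d} (z ∷ u) = trans (cong₂ _⊞_ zero-column (zero-columns-· u)) (⊞-identityʳ (zeroℤ d))
  where
  zero-column : map (λ a → z ℤ.* + a) (0ᵛ d) ≡ zeroℤ d
  zero-column = trans (map-replicate _ 0 d) (cong (replicate d) (ℤP.*-zeroʳ z))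

pad-· : ∀ d {d' n} (B : Config d' n) (u : Vec ℤ n) → map (0ᵛ d ++_) B · u ≡ zeroℤ d ++ B · u
pad-· d B u = begin
    map (0ᵛ d ++_) B · u                    ≡⟨ cong (_· u) (sym (zipWith-replicate₁ _++_ (0ᵛ d) B)) ⟩
    zipWith _++_ (replicate _ (0ᵛ d)) B · u  ≡⟨ ·-rows (replicate _ (0ᵛ d)) B u ⟩
    replicate _ (0ᵛ d) · u ++ B · u          ≡⟨ cong (_++ B · u) (zero-columns-· u) ⟩
    zeroℤ d ++ B · u                         ∎
  where open ≡-Reasoning

identity-· : ∀ {n} (u : Vec ℤ n) → tabulate unitVec · u ≡ u
identity-· [] = refl
identity-· {suc n} (z ∷ u) = begin
    zipWith ℤ._+_ (map h (unitVec zero)) (tabulate (λ j → unitVec (suc j)) · u)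
  ≡⟨ cong₂ (λ c B → zipWith ℤ._+_ (map h c) (B · u)) (unitVec-zero n) (tabulate-∘ (0 ∷_) unitVec) ⟩
    zipWith ℤ._+_ (map h (1 ∷ 0ᵛ n)) (map (0 ∷_) (tabulate unitVec) · u)
  ≡⟨ cong (zipWith ℤ._+_ (map h (1 ∷ 0ᵛ n))) (pad-· 1 (tabulate unitVec) u) ⟩
    (h 1 ℤ.+ + 0) ∷ (map h (0ᵛ n) ⊞ tabulate unitVec · u)
  ≡⟨ cong₂ _∷_ (trans (ℤP.+-identityʳ (h 1)) (ℤP.*-identityʳ z))
               (trans (cong₂ _⊞_ (trans (map-replicate h 0 n) (cong (replicate n) (ℤP.*-zeroʳ z))) (identity-· u))
                      (⊞-identityˡ u)) ⟩
    z ∷ u ∎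
  where
  open ≡-Reasoning
  h = λ a → z ℤ.* + a

byBlocks : ∀ {m n} N → (Fin N → Fin n → Vec ℕ m) → Config m (N * n)
byBlocks N f = concat (tabulate (λ k → tabulate (f k)))

tabulate-++ : ∀ {A : Set} {n m m'} (f : Fin n → Vec A m) (g : Fin n → Vec A m') →
  tabulate (λ j → f j ++ g j) ≡ zipWith _++_ (tabulate f) (tabulate g)
tabulate-++ {n = zero} f g = refl
tabulate-++ {n = suc n} f g = cong ((f zero ++ g zero) ∷_) (tabulate-++ (λ j → f (suc j)) (λ j → g (suc j)))

byBlocks-++ : ∀ {m m' n} N (f : Fin N → Fin n → Vec ℕ m) (g : Fin N → Fin n → Vec ℕ m') →
  byBlocks N (λ k j → f k j ++ g k j) ≡ zipWith _++_ (byBlocks N f) (byBlocks N g)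
byBlocks-++ zero f g = refl
byBlocks-++ (suc N) f g = begin
    tabulate (λ j → f zero j ++ g zero j) ++ byBlocks N (λ k j → f (suc k) j ++ g (suc k) j)
  ≡⟨ cong₂ _++_ (tabulate-++ (f zero) (g zero)) (byBlocks-++ N (λ k → f (suc k)) (λ k → g (suc k))) ⟩
    zipWith _++_ (tabulate (f zero)) (tabulate (g zero)) ++ zipWith _++_ (byBlocks N f′) (byBlocks N g′)
  ≡⟨ sym (zipWith-++ _++_ (tabulate (f zero)) (byBlocks N f′) (tabulate (g zero)) (byBlocks N g′)) ⟩
    zipWith _++_ (byBlocks (suc N) f) (byBlocks (suc N) g) ∎
  where
  open ≡-Reasoning
  f′ = λ k → f (suc k)
  g′ = λ k → g (suc k)

placed : ∀ {d n} N → Config d n → Fin N → Fin n → Vec ℕ (N * d)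
placed {d} N A k j = concat (tabulate (λ k' → if does (k' FinP.≟ k) then lookup A j else 0ᵛ d))

concat-0ᵛ : ∀ d N → concat (tabulate {n = N} (λ _ → 0ᵛ d)) ≡ 0ᵛ (N * d)
concat-0ᵛ d zero = refl
concat-0ᵛ d (suc N) = trans (cong (0ᵛ d ++_) (concat-0ᵛ d N)) (replicate-++ 0 d (N * d))

placed-· : ∀ {d n} N (A : Config d n) (W : Vec (Vec ℤ n) N) →
  byBlocks N (placed N A) · concat W ≡ concat (map (A ·_) W)
placed-· zero A [] = refl
placed-· {d} {n} (suc N) A (w ∷ W) = begin
    (first ++ rest) · (w ++ concat W)               ≡⟨ ·-++ first rest w (concat W) ⟩
    first · w ⊞ rest · concat W                       ≡⟨ cong₂ _⊞_ first-· rest-· ⟩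
    (A · w ++ zeroℤ (N * d)) ⊞ (zeroℤ d ++ concat (map (A ·_) W))
                                                      ≡⟨ zipWith-++ ℤ._+_ (A · w) (zeroℤ (N * d)) (zeroℤ d) _ ⟩
    (A · w ⊞ zeroℤ d) ++ (zeroℤ (N * d) ⊞ concat (map (A ·_) W))
                                                      ≡⟨ cong₂ _++_ (⊞-identityʳ (A · w)) (⊞-identityˡ _) ⟩
    A · w ++ concat (map (A ·_) W)                    ∎
  where
  open ≡-Reasoning
  first = tabulate (placed (suc N) A zero)
  rest = byBlocks N (λ k → placed (suc N) A (suc k))
  zeroBlock : Vec ℕ (N * d)
  zeroBlock = concat (tabulate {n = N} (λ _ → 0ᵛ d))
  first-· : first · w ≡ A · w ++ zeroℤ (N * d)
  first-· = begin
      first · w                                          ≡⟨ cong (_· w) (tabulate-++ (lookup A) (λ _ → zeroBlock)) ⟩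
      zipWith _++_ (tabulate (lookup A)) zeros · w      ≡⟨ ·-rows (tabulate (lookup A)) zeros w ⟩
      tabulate (lookup A) · w ++ zeros · w              ≡⟨ cong₂ _++_ (cong (_· w) (tabulate∘lookup A)) zeros-· ⟩
      A · w ++ zeroℤ (N * d)                             ∎
    where
    zeros : Config (N * d) n
    zeros = tabulate (λ _ → zeroBlock)
    zeros-· : zeros · w ≡ zeroℤ (N * d)
    zeros-· = trans (cong (_· w) (trans (tabulate-allFin _) (trans (map-const _ _) (cong (replicate n) (concat-0ᵛ d N)))))
                    (zero-columns-· w)
  rest-· : rest · concat W ≡ zeroℤ d ++ concat (map (A ·_) W)
  rest-· = begin
      rest · concat W                             ≡⟨ cong (_· concat W) (sym (shift N)) ⟩
      map (0ᵛ d ++_) (byBlocks N (placed N A)) · concat W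
                                                  ≡⟨ pad-· d (byBlocks N (placed N A)) (concat W) ⟩
      zeroℤ d ++ byBlocks N (placed N A) · concat W  ≡⟨ cong (zeroℤ d ++_) (placed-· N A W) ⟩
      zeroℤ d ++ concat (map (A ·_) W)            ∎
    where
    shift : ∀ N → map (0ᵛ d ++_) (byBlocks N (placed N A)) ≡ byBlocks N (λ k → placed (suc N) A (suc k))
    shift N = trans (map-concat (0ᵛ d ++_) (tabulate (λ k → tabulate (placed N A k))))
                    (cong concat (trans (sym (tabulate-∘ (map (0ᵛ d ++_)) (λ k → tabulate (placed N A k))))
                                        (tabulate-cong (λ k → sym (tabulate-∘ (0ᵛ d ++_) (placed N A k))))))

sumBlocks : ∀ {n N} → Vec (Vec ℤ n) N → Vec ℤ n
sumBlocks {n} [] = zeroℤ n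
sumBlocks (w ∷ W) = w ⊞ sumBlocks W

units-· : ∀ {n} N (W : Vec (Vec ℤ n) N) → byBlocks N (λ _ → unitVec) · concat W ≡ sumBlocks W
units-· zero [] = refl
units-· (suc N) (w ∷ W) =
  trans (·-++ (tabulate unitVec) (byBlocks N (λ _ → unitVec)) w (concat W)) (cong₂ _⊞_ (identity-· w) (units-· N W))

lawrence-· : ∀ {d n} N (A : Config d n) (W : Vec (Vec ℤ n) N) →
  Lawrence N A · concat W ≡ concat (map (A ·_) W) ++ sumBlocks W
lawrence-· N A W = begin
    Lawrence N A · concat W
  ≡⟨ cong (_· concat W) (byBlocks-++ N (placed N A) (λ _ → unitVec)) ⟩
    zipWith _++_ (byBlocks N (placed N A)) (byBlocks N (λ _ → unitVec)) · concat W
  ≡⟨ ·-rows (byBlocks N (placed N A)) (byBlocks N (λ _ → unitVec)) (concat W) ⟩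
    byBlocks N (placed N A) · concat W ++ byBlocks N (λ _ → unitVec) · concat W
  ≡⟨ cong₂ _++_ (placed-· N A W) (units-· N W) ⟩
    concat (map (A ·_) W) ++ sumBlocks W ∎
  where open ≡-Reasoning

toℤ-⊕ : ∀ {n} (u v : Vec ℕ n) → toℤ (u ⊕ v) ≡ toℤ u ⊞ toℤ v
toℤ-⊕ [] [] = refl
toℤ-⊕ (a ∷ u) (b ∷ v) = cong (+ (a + b) ∷_) (toℤ-⊕ u v)

lawrence-table : ∀ {d n} N (A : Config d n) (X : Table n N) →
  Lawrence N A · toℤ (concat X) ≡ toℤ (concat (map (A ·ℕ_) X) ++ total X)
lawrence-table N A X = begin
    Lawrence N A · toℤ (concat X)                          ≡⟨ cong (Lawrence N A ·_) (map-concat +_ X) ⟩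
    Lawrence N A · concat (map toℤ X)                       ≡⟨ lawrence-· N A (map toℤ X) ⟩
    concat (map (A ·_) (map toℤ X)) ++ sumBlocks (map toℤ X) ≡⟨ cong₂ _++_ (images X) (sums X) ⟩
    toℤ (concat (map (A ·ℕ_) X)) ++ toℤ (total X)           ≡⟨ sym (map-++ +_ (concat (map (A ·ℕ_) X)) (total X)) ⟩
    toℤ (concat (map (A ·ℕ_) X) ++ total X)                 ∎
  where
  open ≡-Reasoning
  images : ∀ {N} (X : Table _ N) → concat (map (A ·_) (map toℤ X)) ≡ toℤ (concat (map (A ·ℕ_) X))
  images [] = refl
  images (r ∷ X) = trans (cong₂ _++_ (toℤ-· A r) (images X)) (sym (map-++ +_ (A ·ℕ r) (concat (map (A ·ℕ_) X))))
  sums : ∀ {N} (X : Table _ N) → sumBlocks (map toℤ X) ≡ toℤ (total X)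
  sums [] = sym (map-replicate +_ 0 _)
  sums (r ∷ X) = trans (cong (toℤ r ⊞_) (sums X)) (sym (toℤ-⊕ r (total X)))

concat-map-injective : ∀ {d n N} (f : Vec ℕ n → Vec ℕ d) (X Y : Table n N) →
  concat (map f X) ≡ concat (map f Y) → Pointwise (λ p q → f p ≡ f q) X Y
concat-map-injective f [] [] _ = []
concat-map-injective f (p ∷ X) (q ∷ Y) e =
  ++-injectiveˡ (f p) (f q) e ∷ concat-map-injective f X Y (++-injectiveʳ (f p) (f q) e)

lawrence-fiber : ∀ {d n} N (A : Config d n) (X Y : Table n N) →
  Lawrence N A · toℤ (concat X) ≡ Lawrence N A · toℤ (concat Y) → SameImages A X Y × total X ≡ total Y
lawrence-fiber N A X Y e =
    concat-map-injective (A ·ℕ_) X Y (++-injectiveˡ (concat (map (A ·ℕ_) X)) (concat (map (A ·ℕ_) Y)) e')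
  , ++-injectiveʳ (concat (map (A ·ℕ_) X)) (concat (map (A ·ℕ_) Y)) e'
  where e' = toℤ-injective _ _ (trans (sym (lawrence-table N A X)) (trans e (lawrence-table N A Y)))

take-++ : ∀ {A : Set} {n m} (r : Vec A n) (rest : Vec A m) → take n (r ++ rest) ≡ r
take-++ [] rest = refl
take-++ {n = suc n} (x ∷ r) rest = trans (unfold-take n x (r ++ rest)) (cong (x ∷_) (take-++ r rest))

drop-++ : ∀ {A : Set} {n m} (r : Vec A n) (rest : Vec A m) → drop n (r ++ rest) ≡ rest
drop-++ [] rest = refl
drop-++ {n = suc n} (x ∷ r) rest = trans (unfold-drop n x (r ++ rest)) (drop-++ r rest)

blocks-concat : ∀ {A : Set} N n (V : Vec (Vec A n) N) → blocks N n (concat V) ≡ V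
blocks-concat zero n [] = refl
blocks-concat (suc N) n (r ∷ V) =
  cong₂ _∷_ (take-++ r (concat V)) (trans (cong (blocks N n) (drop-++ r (concat V))) (blocks-concat N n V))

concat-blocks : ∀ {A : Set} N n (x : Vec A (N * n)) → concat (blocks N n x) ≡ x
concat-blocks zero n [] = refl
concat-blocks (suc N) n x = trans (cong (take n x ++_) (concat-blocks N n (drop n x))) (take++drop≡id n x)

nonzero : ∀ {n} → Vec ℤ n → ℕ
nonzero w = if isZeroVec w then 0 else 1

nonzero≤1 : ∀ {n} (w : Vec ℤ n) → nonzero w ≤ 1
nonzero≤1 w with isZeroVec w
... | true = z≤n
... | false = s≤s z≤n

isZeroVec-zeroℤ : ∀ n → isZeroVec (zeroℤ n) ≡ true
isZeroVec-zeroℤ zero = refl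
isZeroVec-zeroℤ (suc n) = isZeroVec-zeroℤ n

isZeroVec-sound : ∀ {n} (w : Vec ℤ n) → isZeroVec w ≡ true → w ≡ zeroℤ n
isZeroVec-sound [] _ = refl
isZeroVec-sound (+ zero ∷ w) e = cong (+ 0 ∷_) (isZeroVec-sound w e)

nonzero-diff-self : ∀ {n} (p : Vec ℕ n) → nonzero (diff p p) ≡ 0
nonzero-diff-self {n} p = trans (cong nonzero (diff-self p)) (cong (λ b → if b then 0 else 1) (isZeroVec-zeroℤ n))

changedRows : ∀ {n N} → Table n N → Table n N → ℕ
changedRows X' X = sum (map nonzero (zipWith diff X' X))

changedRows-self : ∀ {n N} (X : Table n N) → changedRows X X ≡ 0
changedRows-self [] = refl
changedRows-self (p ∷ X) = cong₂ _+_ (nonzero-diff-self p) (changedRows-self X)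

changedRows-replaced : ∀ {n N r r'} {X X' : Table n N} → Replaced X X' r r' → changedRows X' X ≤ 1
changedRows-replaced {r = r} {r'} {X = _ ∷ X} here =
  subst (λ t → nonzero (diff r' r) + t ≤ 1) (sym (changedRows-self X))
        (subst (_≤ 1) (sym (ℕP.+-identityʳ _)) (nonzero≤1 (diff r' r)))
changedRows-replaced {X = s ∷ X} {_ ∷ X'} (there rep) =
  subst (λ t → t + changedRows X' X ≤ 1) (sym (nonzero-diff-self s)) (changedRows-replaced rep)

changedRows-swap : ∀ {d n N} {A : Config d n} {X X' : Table n N} → SwapStep A X X' → changedRows X' X ≤ 2
changedRows-swap (swap {p = p} {p'} _ _ _ rep) = ℕP.+-mono-≤ (nonzero≤1 (diff p' p)) (changedRows-replaced rep)
changedRows-swap {X = p ∷ X} {_ ∷ X'} (later st) =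
  subst (λ t → t + changedRows X' X ≤ 2) (sym (nonzero-diff-self p)) (changedRows-swap st)

diff-concat : ∀ {n N} (X' X : Table n N) → diff (concat X') (concat X) ≡ concat (zipWith diff X' X)
diff-concat [] [] = refl
diff-concat (p' ∷ X') (p ∷ X) =
  trans (cong₂ (zipWith ℤ._-_) (map-++ +_ p' (concat X')) (map-++ +_ p (concat X)))
        (trans (zipWith-++ ℤ._-_ (toℤ p') (toℤ (concat X')) (toℤ p) (toℤ (concat X)))
               (cong (diff p' p ++_) (diff-concat X' X)))

typeOf-table : ∀ {n} N (X' X : Table n N) → typeOf N n (diff (concat X') (concat X)) ≡ changedRows X' X
typeOf-table {n} N X' X = trans (cong (λ z → sum (map nonzero (blocks N n z))) (diff-concat X' X))
                                 (cong (λ V → sum (map nonzero V)) (blocks-concat N n (zipWith diff X' X)))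

swap-lawrence-step : ∀ {d n} N (A : Config d n) {b'} {X X' : Table n N} → SwapStep A X X' →
  Lawrence N A · toℤ (concat X) ≡ b' → Step (Lawrence N A) b' (MovesType≤ N A 2) (concat X) (concat X')
swap-lawrence-step N A {X = X} {X'} st hX =
  forward (Lawrence N A) (MovesType≤ N A 2) hX same-image
    (diff-isMove (Lawrence N A) same-image , subst (_≤ 2) (sym (typeOf-table N X' X)) (changedRows-swap st))
  where
  same-image : Lawrence N A ·ℕ concat X' ≡ Lawrence N A ·ℕ concat X
  same-image = ·⇒·ℕ (Lawrence N A) (trans (lawrence-table N A X')
    (trans (cong toℤ (cong₂ _++_ (cong concat (swap-images st)) (swap-total st))) (sym (lawrence-table N A X))))

mc≤2 : ∀ {d n} (A : Config d n) → SwapConnected A → MCbound A 2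
mc≤2 {n = n} A connected N _ b' x y hx hy =
  subst₂ (Star (Step (Lawrence N A) b' (MovesType≤ N A 2))) (concat-blocks N n x) (concat-blocks N n y)
         (walk (connected N X Y (proj₁ fiber) (proj₂ fiber)) hX)
  where
  X = blocks N n x
  Y = blocks N n y
  hX : Lawrence N A · toℤ (concat X) ≡ b'
  hX = subst (λ t → Lawrence N A · toℤ t ≡ b') (sym (concat-blocks N n x)) hx
  hY : Lawrence N A · toℤ (concat Y) ≡ b'
  hY = subst (λ t → Lawrence N A · toℤ t ≡ b') (sym (concat-blocks N n y)) hy
  fiber = lawrence-fiber N A X Y (trans hX (sym hY))
  walk : ∀ {X X'} → Star (SwapStep A) X X' → Lawrence N A · toℤ (concat X) ≡ b' →
    Star (Step (Lawrence N A) b' (MovesType≤ N A 2)) (concat X) (concat X')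
  walk ε _ = ε
  walk (st ◅ path) hX = s ◅ walk path (proj₁ (proj₂ s))
    where s = swap-lawrence-step N A st hX

-- A move of A^(2) of type ≤ 1 is zero: its two blocks sum to zero and one of them vanishes.
type≤1-zero : ∀ {d n} (A : Config d n) m → m ≤ 1 → ∀ z → MovesType≤ 2 A m z → z ≡ zeroℤ (2 * n)
type≤1-zero {d} {n} A m m≤1 z (move , type) =
  trans (sym (concat-blocks 2 n z)) (both-zero (isZeroVec w₀) refl (isZeroVec w₁) refl (ℕP.≤-trans type m≤1))
  where
  w₀ = take n z
  w₁ = take n (drop n z)
  images : concat (map (A ·_) (blocks 2 n z)) ++ sumBlocks (blocks 2 n z) ≡ zeroℤ (2 * d) ++ zeroℤ n
  images = trans (sym (lawrence-· 2 A (blocks 2 n z)))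
    (trans (cong (Lawrence 2 A ·_) (concat-blocks 2 n z)) (trans move (sym (replicate-++ (+ 0) (2 * d) n))))
  sum-zero : w₀ ⊞ (w₁ ⊞ zeroℤ n) ≡ zeroℤ n
  sum-zero = ++-injectiveʳ (concat (map (A ·_) (blocks 2 n z))) (zeroℤ (2 * d)) images
  concat-zero : w₀ ≡ zeroℤ n → w₁ ≡ zeroℤ n → concat (w₀ ∷ w₁ ∷ []) ≡ zeroℤ (2 * n)
  concat-zero e₀ e₁ = trans (cong₂ (λ s t → s ++ t ++ []) e₀ e₁)
    (trans (cong (zeroℤ n ++_) (replicate-++ (+ 0) n 0)) (replicate-++ (+ 0) n (n + 0)))
  both-zero : ∀ b₀ → isZeroVec w₀ ≡ b₀ → ∀ b₁ → isZeroVec w₁ ≡ b₁ →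
    (if b₀ then 0 else 1) + ((if b₁ then 0 else 1) + 0) ≤ 1 → concat (w₀ ∷ w₁ ∷ []) ≡ zeroℤ (2 * n)
  both-zero false _ false _ (s≤s ())
  both-zero true e₀ _ _ _ = concat-zero w₀≡0 (begin
      w₁                          ≡⟨ sym (⊞-identityʳ w₁) ⟩
      w₁ ⊞ zeroℤ n                ≡⟨ sym (⊞-identityˡ _) ⟩
      zeroℤ n ⊞ (w₁ ⊞ zeroℤ n)    ≡⟨ cong (_⊞ (w₁ ⊞ zeroℤ n)) (sym w₀≡0) ⟩
      w₀ ⊞ (w₁ ⊞ zeroℤ n)         ≡⟨ sum-zero ⟩
      zeroℤ n                     ∎)
    where
    open ≡-Reasoning
    w₀≡0 = isZeroVec-sound w₀ e₀
  both-zero false _ true e₁ _ = concat-zero (begin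
      w₀                          ≡⟨ sym (⊞-identityʳ w₀) ⟩
      w₀ ⊞ zeroℤ n                ≡⟨ cong (w₀ ⊞_) (sym (trans (cong (_⊞ zeroℤ n) w₁≡0) (⊞-identityˡ (zeroℤ n)))) ⟩
      w₀ ⊞ (w₁ ⊞ zeroℤ n)         ≡⟨ sum-zero ⟩
      zeroℤ n                     ∎) w₁≡0
    where
    open ≡-Reasoning
    w₁≡0 = isZeroVec-sound w₁ e₁

-- Lower bound: two distinct points u ≠ v of one fiber of A give the points (u, v) and (v, u)
-- of one fiber of A^(2), which moves of type ≤ 1 cannot connect.
mc≥2 : ∀ {d n} (A : Config d n) (u v : Vec ℕ n) → u ≢ v → A ·ℕ u ≡ A ·ℕ v → ∀ m → MCbound A m → 2 ≤ m
mc≥2 {n = n} A u v u≢v e m bound with 2 ℕP.≤? m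
... | yes 2≤m = 2≤m
... | no 2≰m = ⊥-elim (u≢v (++-injectiveˡ u v (stuck (Lawrence 2 A) b' (MovesType≤ 2 A m)
        (zero-move-step (Lawrence 2 A) b' (MovesType≤ 2 A m) (type≤1-zero A m (ℕP.≤-pred (ℕP.≰⇒> 2≰m))))
        (bound 2 (s≤s z≤n) b' x y refl (sym same-image)))))
  where
  x = concat (u ∷ v ∷ [])
  y = concat (v ∷ u ∷ [])
  b' = Lawrence 2 A · toℤ x
  same-image : Lawrence 2 A · toℤ x ≡ Lawrence 2 A · toℤ y
  same-image = trans (lawrence-table 2 A (u ∷ v ∷ []))
    (trans (cong toℤ (cong₂ _++_ (cong₂ (λ s t → s ++ t ++ []) e (sym e))
                                 (solve 3 (λ u v o → u ∙ (v ∙ o) ⊜ v ∙ (u ∙ o)) refl u v (0ᵛ n))))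
           (sym (lawrence-table 2 A (v ∷ u ∷ []))))
    where open ⊕-Solver

rowsOf : ∀ {m k} → (Fin k → Vec ℕ m) → (x : Vec ℕ k) → Table m (sum x)
rowsOf f [] = []
rowsOf f (x₀ ∷ x) = replicate x₀ (f zero) ++ rowsOf (λ i → f (suc i)) x

total-++ : ∀ {n N M} (X : Table n N) (Y : Table n M) → total (X ++ Y) ≡ total X ⊕ total Y
total-++ [] Y = sym (⊕-identityˡ _)
total-++ (r ∷ X) Y = trans (cong (r ⊕_) (total-++ X Y)) (sym (⊕-assoc r (total X) (total Y)))

total-replicate : ∀ {n} m (r : Vec ℕ n) → total (replicate m r) ≡ m ⊙ r
total-replicate zero r = sym (0⊙ r)
total-replicate (suc m) r =
  trans (cong (r ⊕_) (total-replicate m r)) (sym (trans (⊙-distribʳ 1 m r) (cong (_⊕ m ⊙ r) (1⊙ r))))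

total-rowsOf : ∀ {m k} (f : Fin k → Vec ℕ m) (x : Vec ℕ k) → total (rowsOf f x) ≡ tabulate f ·ℕ x
total-rowsOf f [] = refl
total-rowsOf f (x₀ ∷ x) = trans (total-++ (replicate x₀ (f zero)) (rowsOf (λ i → f (suc i)) x))
                               (cong₂ _⊕_ (total-replicate x₀ (f zero)) (total-rowsOf (λ i → f (suc i)) x))

map-rowsOf : ∀ {m m' k} (g : Vec ℕ m → Vec ℕ m') (f : Fin k → Vec ℕ m) (x : Vec ℕ k) →
  map g (rowsOf f x) ≡ rowsOf (λ i → g (f i)) x
map-rowsOf g f [] = refl
map-rowsOf g f (x₀ ∷ x) = trans (map-++ g (replicate x₀ (f zero)) (rowsOf (λ i → f (suc i)) x))
                               (cong₂ _++_ (map-replicate g (f zero) x₀) (map-rowsOf g (λ i → f (suc i)) x))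

replaced-map : ∀ {n m N r r'} (g : Vec ℕ n → Vec ℕ m) {X X' : Table n N} → Replaced X X' r r' →
  Replaced (map g X) (map g X') (g r) (g r')
replaced-map g here = here
replaced-map g (there rep) = there (replaced-map g rep)

identity-·ℕ : ∀ {n} (x : Vec ℕ n) → tabulate unitVec ·ℕ x ≡ x
identity-·ℕ x = toℤ-injective _ _ (trans (sym (toℤ-· (tabulate unitVec) x)) (identity-· (toℤ x)))

sum≡0⇒0ᵛ : ∀ {m} (u : Vec ℕ m) → sum u ≡ 0 → u ≡ 0ᵛ m
sum≡0⇒0ᵛ [] _ = refl
sum≡0⇒0ᵛ (a ∷ u) e = cong₂ _∷_ (ℕP.m+n≡0⇒m≡0 a e) (sum≡0⇒0ᵛ u (ℕP.m+n≡0⇒n≡0 a e))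

sum≡1⇒unitVec : ∀ {m} (u : Vec ℕ m) → sum u ≡ 1 → Σ (Fin m) λ a → u ≡ unitVec a
sum≡1⇒unitVec (zero ∷ u) e = let (a , u≡eₐ) = sum≡1⇒unitVec u e in suc a , cong (0 ∷_) u≡eₐ
sum≡1⇒unitVec {suc m} (suc zero ∷ u) e =
  zero , trans (cong (1 ∷_) (sum≡0⇒0ᵛ u (ℕP.suc-injective e))) (sym (unitVec-zero m))
sum≡1⇒unitVec (suc (suc a) ∷ u) ()

-- x + (y ∸ x) = y + (x ∸ y): both are the pointwise maximum.
max-split : ∀ {n} (x y : Vec ℕ n) → x ⊕ zipWith _∸_ y x ≡ y ⊕ zipWith _∸_ x y
max-split [] [] = refl
max-split (a ∷ x) (b ∷ y) = cong₂ _∷_ (max a b) (max-split x y)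
  where
  max : ∀ a b → a + (b ∸ a) ≡ b + (a ∸ b)
  max a b with ℕP.≤-total a b
  ... | inj₁ a≤b = trans (ℕP.m+[n∸m]≡n a≤b) (trans (sym (ℕP.+-identityʳ b)) (cong (λ t → b + t) (sym (ℕP.m≤n⇒m∸n≡0 a≤b))))
  ... | inj₂ b≤a = trans (cong (λ t → a + t) (ℕP.m≤n⇒m∸n≡0 b≤a)) (trans (ℕP.+-identityʳ a) (sym (ℕP.m+[n∸m]≡n b≤a)))

-- A configuration of pairwise distinct zero columns has at most one column, and every fiber
-- is connected by moves of degree 0 (in the one-column case, walk downwards).
zero-columns-md : ∀ {n m} (C : Config n m) → (∀ a → lookup C a ≡ 0ᵛ n) →
  (∀ a a' → lookup C a ≡ lookup C a' → a ≡ a') → IsMD C 0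
zero-columns-md [] _ _ = (λ { b' [] [] _ _ → ε }) , λ _ _ → z≤n
zero-columns-md (c ∷ []) _ _ = basis , λ _ _ → z≤n
  where
  one-step : ∀ b' x₀ y₀ → (c ∷ []) · toℤ (x₀ ∷ []) ≡ b' → (c ∷ []) · toℤ (y₀ ∷ []) ≡ b' → y₀ ≤ x₀ →
    MovesDeg≤ (c ∷ []) 0 (diff (y₀ ∷ []) (x₀ ∷ []))
  one-step b' x₀ y₀ hx hy y≤x =
    diff-isMove (c ∷ []) {x₀ ∷ []} {y₀ ∷ []} (·⇒·ℕ (c ∷ []) {y₀ ∷ []} {x₀ ∷ []} (trans hy (sym hx))) ,
    ℕP.≤-reflexive (trans (deg-diff (y₀ ∷ []) (x₀ ∷ [])) (cong (_+ 0) (ℕP.m≤n⇒m∸n≡0 y≤x)))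
  basis : IsMarkovBasis (c ∷ []) (MovesDeg≤ (c ∷ []) 0)
  basis b' (x₀ ∷ []) (y₀ ∷ []) hx hy with ℕP.≤-total y₀ x₀
  ... | inj₁ y≤x = (hx , hy , inj₁ (one-step b' x₀ y₀ hx hy y≤x)) ◅ ε
  ... | inj₂ x≤y = (hx , hy , inj₂ (one-step b' y₀ x₀ hy hx x≤y)) ◅ ε
zero-columns-md (c ∷ c' ∷ C) zero-cols distinct
  with distinct zero (suc zero) (trans (zero-cols zero) (sym (zero-cols (suc zero))))
... | ()

-- A point x of a fiber of C is
-- recorded by the table rowsOf (lookup C) x listing column a of C x_a times; conversely a table
-- of points of F_{A,b} is recorded by its vector of counts.  Swap steps of tables become
-- quadratic moves of C, so MD(C) ≤ 2.
module FiberMatrix {d n k} (A : Config d n) (b : Vec ℕ d) (C : Config n k) (fib : IsFiberMatrix A b C)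
  (h : ℕ) (h≢0 : h ≢ 0) (A-homogeneous : ∀ x → sum (A ·ℕ x) ≡ h * sum x) (connected : SwapConnected A) where

  InFiber : Vec ℕ n → Set
  InFiber p = A ·ℕ p ≡ b

  toFiber : ∀ {p} → A · toℤ p ≡ toℤ b → InFiber p
  toFiber {p} e = toℤ-injective _ _ (trans (sym (toℤ-· A p)) e)

  column-in-fiber : ∀ a → InFiber (lookup C a)
  column-in-fiber a = toFiber (Equivalence.from (proj₁ fib (lookup C a)) (∈-lookup a C))
    where
    ∈-lookup : ∀ {m} (a : Fin m) (C' : Config n m) → lookup C' a ∈ C'
    ∈-lookup zero (c ∷ C') = Any.here refl
    ∈-lookup (suc a) (c ∷ C') = Any.there (∈-lookup a C')

  column-of : ∀ {p} → InFiber p → Σ (Fin k) λ a → lookup C a ≡ p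
  column-of {p} e = index (Equivalence.to (proj₁ fib p) (trans (toℤ-· A p) (cong toℤ e)))
    where
    index : ∀ {m} {C' : Config n m} → p ∈ C' → Σ (Fin m) λ a → lookup C' a ≡ p
    index (Any.here p≡c) = zero , sym p≡c
    index (Any.there p∈C') = let (a , e) = index p∈C' in suc a , e

  distinct : ∀ a a' → lookup C a ≡ lookup C a' → a ≡ a'
  distinct = proj₂ fib

  -- The count vector of a single point: the unit vector of its column (zero outside the fiber).
  count : Vec ℕ n → Vec ℕ k
  count r = tabulate (λ a → if does (≡-dec ℕP._≟_ (lookup C a) r) then 1 else 0)

  count-column : ∀ a → count (lookup C a) ≡ unitVec a
  count-column a = tabulate-cong entry
    where
    entry : ∀ a' → (if does (≡-dec ℕP._≟_ (lookup C a') (lookup C a)) then 1 else 0)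
                   ≡ (if does (a' FinP.≟ a) then 1 else 0)
    entry a' with ≡-dec ℕP._≟_ (lookup C a') (lookup C a) | a' FinP.≟ a
    ... | yes _ | yes _ = refl
    ... | yes e | no a'≢a = ⊥-elim (a'≢a (distinct a' a e))
    ... | no c≢c | yes refl = ⊥-elim (c≢c refl)
    ... | no _ | no _ = refl

  counts : ∀ {N} → Table n N → Vec ℕ k
  counts X = total (map count X)

  counts-rowsOf : ∀ x → counts (rowsOf (lookup C) x) ≡ x
  counts-rowsOf x = begin
      total (map count (rowsOf (lookup C) x))            ≡⟨ cong total (map-rowsOf count (lookup C) x) ⟩
      total (rowsOf (λ a → count (lookup C a)) x)        ≡⟨ total-rowsOf _ x ⟩
      tabulate (λ a → count (lookup C a)) ·ℕ x           ≡⟨ cong (_·ℕ x) (tabulate-cong count-column) ⟩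
      tabulate unitVec ·ℕ x                              ≡⟨ identity-·ℕ x ⟩
      x                                                  ∎
    where open ≡-Reasoning

  total-rowsOf-C : ∀ x → total (rowsOf (lookup C) x) ≡ C ·ℕ x
  total-rowsOf-C x = trans (total-rowsOf (lookup C) x) (cong (_·ℕ x) (tabulate∘lookup C))

  rowsOf-in-fiber : ∀ {m} (C' : Config n m) → (∀ a → InFiber (lookup C' a)) →
    ∀ x → All InFiber (rowsOf (lookup C') x)
  rowsOf-in-fiber [] _ [] = []
  rowsOf-in-fiber (c ∷ C') cols (x₀ ∷ x) =
    ++⁺ (replicate⁺ x₀ (cols zero)) (rowsOf-in-fiber C' (λ a → cols (suc a)) x)
    where
    replicate⁺ : ∀ m {r} → InFiber r → All InFiber (replicate m r)
    replicate⁺ zero _ = []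
    replicate⁺ (suc m) e = e ∷ replicate⁺ m e

  C-counts : ∀ {N} (X : Table n N) → All InFiber X → C ·ℕ counts X ≡ total X
  C-counts [] [] = ·ℕ-0ᵛ C
  C-counts (r ∷ X) (e ∷ es) = trans (·ℕ-⊕ C (count r) (counts X)) (cong₂ _⊕_ C-count (C-counts X es))
    where
    C-count : C ·ℕ count r ≡ r
    C-count with column-of e
    ... | a , refl = trans (cong (C ·ℕ_) (count-column a)) (·ℕ-unitVec C a)

  Quadratic : Vec ℤ k → Set
  Quadratic z = Σ (Fin k) λ a₁ → Σ (Fin k) λ a₂ → Σ (Fin k) λ c₁ → Σ (Fin k) λ c₂ →
    lookup C a₁ ⊕ lookup C a₂ ≡ lookup C c₁ ⊕ lookup C c₂ ×
    z ≡ diff (unitVec c₁ ⊕ unitVec c₂) (unitVec a₁ ⊕ unitVec a₂)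

  quadratic-deg≤2 : ∀ z → Quadratic z → MovesDeg≤ C 2 z
  quadratic-deg≤2 z (a₁ , a₂ , c₁ , c₂ , relation , refl) = diff-isMove C same-image , degree
    where
    C-pair : ∀ a a' → C ·ℕ (unitVec a ⊕ unitVec a') ≡ lookup C a ⊕ lookup C a'
    C-pair a a' = trans (·ℕ-⊕ C (unitVec a) (unitVec a')) (cong₂ _⊕_ (·ℕ-unitVec C a) (·ℕ-unitVec C a'))
    same-image = trans (C-pair c₁ c₂) (trans (sym relation) (sym (C-pair a₁ a₂)))
    sum-unitVec : ∀ {m} (a : Fin m) → sum (unitVec a) ≡ 1
    sum-unitVec {suc m} zero = cong suc (trans (cong sum (proj₂ (∷-injective (unitVec-zero m)))) (sum-0ᵛ m))
    sum-unitVec (suc a) = sum-unitVec a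
    degree = ℕP.≤-trans (deg-diff≤ (unitVec c₁ ⊕ unitVec c₂) _)
                        (ℕP.≤-reflexive (trans (sum-⊕ (unitVec c₁) (unitVec c₂))
                                               (cong₂ _+_ (sum-unitVec c₁) (sum-unitVec c₂))))

  exchange-quadratic : ∀ {N} (X X' : Table n N) {p r p' r'} → InFiber p → InFiber r → InFiber p' → InFiber r' →
    p' ⊕ r' ≡ p ⊕ r → counts X ⊕ (count p' ⊕ count r') ≡ counts X' ⊕ (count p ⊕ count r) →
    Quadratic (diff (counts X') (counts X))
  exchange-quadratic X X' ep er ep' er' sums counts-eq with column-of ep | column-of er | column-of ep' | column-of er'
  ... | a₁ , refl | a₂ , refl | c₁ , refl | c₂ , refl =
    a₁ , a₂ , c₁ , c₂ , sym sums ,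
    trans (diff-shift _ _ _ _ counts-eq)
          (cong₂ diff (cong₂ _⊕_ (count-column c₁) (count-column c₂))
                      (cong₂ _⊕_ (count-column a₁) (count-column a₂)))

  replaced-row : ∀ {N r r'} {X X' : Table n N} {P : Vec ℕ n → Set} → Replaced X X' r r' → All P X → P r
  replaced-row here (pr ∷ _) = pr
  replaced-row (there rep) (_ ∷ ps) = replaced-row rep ps

  swap-quadratic : ∀ {N} {X X' : Table n N} → SwapStep A X X' → All InFiber X → Quadratic (diff (counts X') (counts X))
  swap-quadratic {X = p ∷ X} {p' ∷ X'} (swap {r = r} {r'} ep er sums rep) (e ∷ es) =
    exchange-quadratic (p ∷ X) (p' ∷ X') e (replaced-row rep es) (trans ep e) (trans er (replaced-row rep es)) sums (begin
      (count p ⊕ counts X) ⊕ (count p' ⊕ count r')    ≡⟨ ⊕-interchange (count p) _ _ _ ⟩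
      (count p ⊕ count p') ⊕ (counts X ⊕ count r')    ≡⟨ cong (count p ⊕ count p' ⊕_) (replaced-total (replaced-map count rep)) ⟩
      (count p ⊕ count p') ⊕ (counts X' ⊕ count r)    ≡⟨ solve 4 (λ a b c d → (a ∙ b) ∙ (c ∙ d) ⊜ (b ∙ c) ∙ (a ∙ d)) refl
                                                            (count p) (count p') (counts X') (count r) ⟩
      (count p' ⊕ counts X') ⊕ (count p ⊕ count r)    ∎)
    where
    open ≡-Reasoning
    open ⊕-Solver
  swap-quadratic {X = p ∷ X} {_ ∷ X'} (later st) (_ ∷ es) = subst Quadratic (sym drop-head) (swap-quadratic st es)
    where
    open ⊕-Solver
    drop-head : diff (count p ⊕ counts X') (count p ⊕ counts X) ≡ diff (counts X') (counts X)
    drop-head = diff-shift _ _ _ _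
      (solve 3 (λ a x x' → (a ∙ x) ∙ x' ⊜ (a ∙ x') ∙ x) refl (count p) (counts X) (counts X'))

  images-in-fiber : ∀ {N} (X X' : Table n N) → map (A ·ℕ_) X' ≡ map (A ·ℕ_) X → All InFiber X → All InFiber X'
  images-in-fiber [] [] _ [] = []
  images-in-fiber (r ∷ X) (r' ∷ X') e (er ∷ es) =
    trans (∷-injectiveˡ e) er ∷ images-in-fiber X X' (∷-injectiveʳ e) es

  same-images : ∀ {N} {X Y : Table n N} → All InFiber X → All InFiber Y → SameImages A X Y
  same-images [] [] = []
  same-images (e ∷ es) (e' ∷ es') = trans e (sym e') ∷ same-images es es'

  walk : ∀ {N b'} {X Y : Table n N} → Star (SwapStep A) X Y → All InFiber X →
    C · toℤ (counts X) ≡ b' → Star (Step C b' Quadratic) (counts X) (counts Y)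
  walk ε _ _ = ε
  walk {X = X} (_◅_ {j = X'} st path) es hX = s ◅ walk path es' (proj₁ (proj₂ s))
    where
    es' = images-in-fiber X X' (swap-images st) es
    same-image = trans (C-counts X' es') (trans (swap-total st) (sym (C-counts X es)))
    s = forward C Quadratic hX same-image (swap-quadratic st es)

  column-sums : ∀ a → h * sum (lookup C a) ≡ sum b
  column-sums a = trans (sym (A-homogeneous (lookup C a))) (cong sum (column-in-fiber a))

  -- If b = 0 all columns of C are zero, so C has at most one column and MD(C) = 0.
  degenerate : sum b ≡ 0 → IsMD C 0
  degenerate sum-b≡0 = zero-columns-md C zero-column distinct
    where
    zero-column : ∀ a → lookup C a ≡ 0ᵛ n
    zero-column a = sum≡0⇒0ᵛ (lookup C a)
      (ℕP.*-cancelˡ-≡ _ 0 h {{≢-nonZero h≢0}} (trans (column-sums a) (trans sum-b≡0 (sym (ℕP.*-zeroʳ h)))))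

  module Nondegenerate (sum-b≢0 : sum b ≢ 0) where

    same-size : ∀ x y → C ·ℕ x ≡ C ·ℕ y → sum x ≡ sum y
    same-size x y e = ℕP.*-cancelˡ-≡ (sum x) (sum y) (sum b) {{≢-nonZero sum-b≢0}} (begin
        sum b * sum x        ≡⟨ sym (homogeneous C h (sum b) column-sums x) ⟩
        h * sum (C ·ℕ x)     ≡⟨ cong (λ v → h * sum v) e ⟩
        h * sum (C ·ℕ y)     ≡⟨ homogeneous C h (sum b) column-sums y ⟩
        sum b * sum y        ∎)
      where open ≡-Reasoning

    quadratic-basis : IsMarkovBasis C Quadratic
    quadratic-basis b' x y hx hy =
      subst₂ (Star (Step C b' Quadratic)) (counts-rowsOf x) (counts-rowsOf y)
        (connect X Y (same-size x y e) (rowsOf-in-fiber C column-in-fiber x) (rowsOf-in-fiber C column-in-fiber y)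
                 (trans (total-rowsOf-C x) (trans e (sym (total-rowsOf-C y))))
                 (subst (λ t → C · toℤ t ≡ b') (sym (counts-rowsOf x)) hx))
      where
      e = ·⇒·ℕ C (trans hx (sym hy))
      X = rowsOf (lookup C) x
      Y = rowsOf (lookup C) y
      connect : ∀ {N N'} (X : Table n N) (Y : Table n N') → N ≡ N' → All InFiber X → All InFiber Y →
        total X ≡ total Y → C · toℤ (counts X) ≡ b' → Star (Step C b' Quadratic) (counts X) (counts Y)
      connect X Y refl es es' tot hX = walk (connected _ X Y (same-images es es') tot) es hX

    -- With y − x = u − v for u = (y − x)₊ and v = (x − y)₊: C u = C v and |u| = |v| ≤ 1, so u, v
    -- are both zero or both unit vectors of columns with the same image, hence equal.
    deg≤1-fixed : ∀ x y → C ·ℕ x ≡ C ·ℕ y → deg (diff y x) ≤ 1 → x ≡ y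
    deg≤1-fixed x y e dg = ⊕-cancelʳ x y u (trans (max-split x y) (cong (y ⊕_) (sym (u≡v (sum u) refl |u|≤1))))
      where
      u = zipWith _∸_ y x
      v = zipWith _∸_ x y
      Cu≡Cv : C ·ℕ u ≡ C ·ℕ v
      Cu≡Cv = ⊕-cancelˡ (C ·ℕ x) _ _ (begin
          C ·ℕ x ⊕ C ·ℕ u      ≡⟨ sym (·ℕ-⊕ C x u) ⟩
          C ·ℕ (x ⊕ u)         ≡⟨ cong (C ·ℕ_) (max-split x y) ⟩
          C ·ℕ (y ⊕ v)         ≡⟨ ·ℕ-⊕ C y v ⟩
          C ·ℕ y ⊕ C ·ℕ v      ≡⟨ cong (_⊕ C ·ℕ v) (sym e) ⟩
          C ·ℕ x ⊕ C ·ℕ v      ∎)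
        where open ≡-Reasoning
      |u|≡|v| = same-size u v Cu≡Cv
      |u|≤1 : sum u ≤ 1
      |u|≤1 = subst (_≤ 1) (deg-diff y x) dg
      u≡v : ∀ s → sum u ≡ s → s ≤ 1 → u ≡ v
      u≡v zero |u|≡0 _ = trans (sum≡0⇒0ᵛ u |u|≡0) (sym (sum≡0⇒0ᵛ v (trans (sym |u|≡|v|) |u|≡0)))
      u≡v (suc zero) |u|≡1 _ with sum≡1⇒unitVec u |u|≡1 | sum≡1⇒unitVec v (trans (sym |u|≡|v|) |u|≡1)
      ... | a , u≡eₐ | a' , v≡eₐ' = trans u≡eₐ (trans (cong unitVec a≡a') (sym v≡eₐ'))
        where
        a≡a' = distinct a a' (trans (sym (·ℕ-unitVec C a))
                 (trans (cong (C ·ℕ_) (sym u≡eₐ)) (trans Cu≡Cv (trans (cong (C ·ℕ_) v≡eₐ') (·ℕ-unitVec C a')))))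
      u≡v (suc (suc _)) _ (s≤s ())

    deg≤1-step : ∀ m → m ≤ 1 → ∀ b' {x y} → Step C b' (MovesDeg≤ C m) x y → x ≡ y
    deg≤1-step m m≤1 b' {x} {y} (hx , hy , inj₁ (_ , dg)) =
      deg≤1-fixed x y (·⇒·ℕ C (trans hx (sym hy))) (ℕP.≤-trans dg m≤1)
    deg≤1-step m m≤1 b' {x} {y} (hx , hy , inj₂ (_ , dg)) =
      sym (deg≤1-fixed y x (·⇒·ℕ C (trans hy (sym hx))) (ℕP.≤-trans dg m≤1))

    QuadraticRelation : Set
    QuadraticRelation = Σ (Fin k) λ a₁ → Σ (Fin k) λ a₂ → Σ (Fin k) λ c₁ → Σ (Fin k) λ c₂ →
      lookup C a₁ ⊕ lookup C a₂ ≡ lookup C c₁ ⊕ lookup C c₂ ×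
      unitVec c₁ ⊕ unitVec c₂ ≢ unitVec a₁ ⊕ unitVec a₂

    quadraticRelation? : Dec QuadraticRelation
    quadraticRelation? = FinP.any? λ a₁ → FinP.any? λ a₂ → FinP.any? λ c₁ → FinP.any? λ c₂ →
      ≡-dec ℕP._≟_ (lookup C a₁ ⊕ lookup C a₂) (lookup C c₁ ⊕ lookup C c₂)
      ×-dec ¬? (≡-dec ℕP._≟_ (unitVec c₁ ⊕ unitVec c₂) (unitVec a₁ ⊕ unitVec a₂))

    -- With a nontrivial quadratic relation, MD(C) = 2: quadratic moves have degree 2, and the two
    -- sides of the relation are distinct points of one fiber, which degree-1 moves cannot connect.
    md-quadratic : QuadraticRelation → IsMD C 2
    md-quadratic (a₁ , a₂ , c₁ , c₂ , relation , nontrivial) =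
      (λ b' x y hx hy → Star-Step-mono {B = C} quadratic-deg≤2 (quadratic-basis b' x y hx hy)) , minimal
      where
      minimal : ∀ m → IsMarkovBasis C (MovesDeg≤ C m) → 2 ≤ m
      minimal m basis with 2 ℕP.≤? m
      ... | yes 2≤m = 2≤m
      ... | no 2≰m = ⊥-elim (nontrivial (sym (stuck C b' (MovesDeg≤ C m) (deg≤1-step m (ℕP.≤-pred (ℕP.≰⇒> 2≰m)) b')
                                                      (basis b' u v refl hv))))
        where
        u = unitVec a₁ ⊕ unitVec a₂
        v = unitVec c₁ ⊕ unitVec c₂
        b' = C · toℤ u
        C-pair : ∀ a a' → C ·ℕ (unitVec a ⊕ unitVec a') ≡ lookup C a ⊕ lookup C a'
        C-pair a a' = trans (·ℕ-⊕ C (unitVec a) (unitVec a')) (cong₂ _⊕_ (·ℕ-unitVec C a) (·ℕ-unitVec C a'))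
        hv : C · toℤ v ≡ b'
        hv = ·ℕ⇒· C (trans (C-pair c₁ c₂) (trans (sym relation) (sym (C-pair a₁ a₂))))

    -- Without one, every quadratic move is zero, so all fibers of C are single points.
    md-none : ¬ QuadraticRelation → IsMD C 0
    md-none none = (λ b' x y hx hy → subst (Star (Step C b' (MovesDeg≤ C 0)) x)
                     (stuck C b' Quadratic (zero-move-step C b' Quadratic trivial) (quadratic-basis b' x y hx hy)) ε)
                 , λ _ _ → z≤n
      where
      trivial : ∀ z → Quadratic z → z ≡ zeroℤ k
      trivial z (a₁ , a₂ , c₁ , c₂ , relation , refl)
        with ≡-dec ℕP._≟_ (unitVec c₁ ⊕ unitVec c₂) (unitVec a₁ ⊕ unitVec a₂)
      ... | yes same = trans (cong (λ s → diff s (unitVec a₁ ⊕ unitVec a₂)) same) (diff-self _)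
      ... | no differ = ⊥-elim (none (a₁ , a₂ , c₁ , c₂ , relation , differ))

  md≤2 : Σ ℕ λ m → IsMD C m × m ≤ 2
  md≤2 with sum b ℕP.≟ 0
  ... | yes sum-b≡0 = 0 , degenerate sum-b≡0 , z≤n
  ... | no sum-b≢0 with Nondegenerate.quadraticRelation? sum-b≢0
  ...   | yes relation = 2 , Nondegenerate.md-quadratic sum-b≢0 relation , ℕP.≤-refl
  ...   | no none = 0 , Nondegenerate.md-none sum-b≢0 none , z≤n

-- The value 2 is attained at b = (2,2,2,2).  Its fiber consists of the six 2-regular
-- multigraphs on K₄ (by `balance` they are symmetric under edge ↦ opposite edge): the three
-- doubled perfect matchings and the three 4-cycles.  The doubled matchings {01,23} and {02,13}
-- add up to twice the 4-cycle 0–1–3–2–0, a nontrivial quadratic relation.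
b-2222 : Vec ℕ 4
b-2222 = 2 ∷ 2 ∷ 2 ∷ 2 ∷ []

C-2222 : Config 6 6
C-2222 =
  (2 ∷ 0 ∷ 0 ∷ 0 ∷ 0 ∷ 2 ∷ []) ∷
  (0 ∷ 2 ∷ 0 ∷ 0 ∷ 2 ∷ 0 ∷ []) ∷
  (0 ∷ 0 ∷ 2 ∷ 2 ∷ 0 ∷ 0 ∷ []) ∷
  (1 ∷ 1 ∷ 0 ∷ 0 ∷ 1 ∷ 1 ∷ []) ∷
  (1 ∷ 0 ∷ 1 ∷ 1 ∷ 0 ∷ 1 ∷ []) ∷
  (0 ∷ 1 ∷ 1 ∷ 1 ∷ 1 ∷ 0 ∷ []) ∷ []

symmetric-in-C-2222 : ∀ a₀ a₁ a₂ → a₀ + a₁ + a₂ ≡ 2 → (a₀ ∷ a₁ ∷ a₂ ∷ a₂ ∷ a₁ ∷ a₀ ∷ []) ∈ C-2222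
symmetric-in-C-2222 0 0 2 _ = Any.there (Any.there (Any.here refl))
symmetric-in-C-2222 0 1 1 _ = Any.there (Any.there (Any.there (Any.there (Any.there (Any.here refl)))))
symmetric-in-C-2222 0 2 0 _ = Any.there (Any.here refl)
symmetric-in-C-2222 1 0 1 _ = Any.there (Any.there (Any.there (Any.there (Any.here refl))))
symmetric-in-C-2222 1 1 0 _ = Any.there (Any.there (Any.there (Any.here refl)))
symmetric-in-C-2222 2 0 0 _ = Any.here refl
symmetric-in-C-2222 0 0 0 ()
symmetric-in-C-2222 0 0 1 ()
symmetric-in-C-2222 0 0 (suc (suc (suc _))) ()
symmetric-in-C-2222 0 1 0 ()
symmetric-in-C-2222 0 1 (suc (suc _)) ()
symmetric-in-C-2222 0 2 (suc _) ()
symmetric-in-C-2222 0 (suc (suc (suc _))) _ ()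
symmetric-in-C-2222 1 0 0 ()
symmetric-in-C-2222 1 0 (suc (suc _)) ()
symmetric-in-C-2222 1 1 (suc _) ()
symmetric-in-C-2222 1 (suc (suc _)) _ ()
symmetric-in-C-2222 2 0 (suc _) ()
symmetric-in-C-2222 2 (suc _) _ ()
symmetric-in-C-2222 (suc (suc (suc _))) _ _ ()

fiber-2222 : ∀ x → A-K4 ·ℕ x ≡ b-2222 → x ∈ C-2222
fiber-2222 x@(a₀ ∷ a₁ ∷ a₂ ∷ a₃ ∷ a₄ ∷ a₅ ∷ []) e =
  subst (_∈ C-2222) symmetric (symmetric-in-C-2222 a₀ a₁ a₂ (∷-injectiveˡ (trans (sym (image-degrees x)) e)))
  where
  q = lookup C-2222 zero
  e' : A-K4 ·ℕ x ≡ A-K4 ·ℕ q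
  e' = e
  a₅≡a₀ : a₅ ≡ a₀
  a₅≡a₀ = sym (ℕP.+-cancelʳ-≡ 2 a₀ a₅ (trans (balance x q e' zero) (ℕP.+-comm 2 a₅)))
  a₄≡a₁ : a₄ ≡ a₁
  a₄≡a₁ = sym (trans (sym (ℕP.+-identityʳ a₁)) (balance x q e' (suc zero)))
  a₃≡a₂ : a₃ ≡ a₂
  a₃≡a₂ = sym (trans (sym (ℕP.+-identityʳ a₂)) (balance x q e' (suc (suc zero))))
  symmetric : (a₀ ∷ a₁ ∷ a₂ ∷ a₂ ∷ a₁ ∷ a₀ ∷ []) ≡ x
  symmetric = cong₂ _∷_ refl (cong₂ _∷_ refl (cong₂ _∷_ refl
                (cong₂ _∷_ (sym a₃≡a₂) (cong₂ _∷_ (sym a₄≡a₁) (cong₂ _∷_ (sym a₅≡a₀) refl)))))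

C-2222-in-fiber : ∀ x → x ∈ C-2222 → A-K4 · toℤ x ≡ toℤ b-2222
C-2222-in-fiber _ (Any.here refl) = refl
C-2222-in-fiber _ (Any.there (Any.here refl)) = refl
C-2222-in-fiber _ (Any.there (Any.there (Any.here refl))) = refl
C-2222-in-fiber _ (Any.there (Any.there (Any.there (Any.here refl)))) = refl
C-2222-in-fiber _ (Any.there (Any.there (Any.there (Any.there (Any.here refl))))) = refl
C-2222-in-fiber _ (Any.there (Any.there (Any.there (Any.there (Any.there (Any.here refl)))))) = refl

position : Row → Fin 6
position (2 ∷ 0 ∷ 0 ∷ _) = zero
position (0 ∷ 2 ∷ 0 ∷ _) = suc zero
position (0 ∷ 0 ∷ 2 ∷ _) = suc (suc zero)
position (1 ∷ 1 ∷ 0 ∷ _) = suc (suc (suc zero))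
position (1 ∷ 0 ∷ 1 ∷ _) = suc (suc (suc (suc zero)))
position _ = suc (suc (suc (suc (suc zero))))

position-lookup : ∀ a → position (lookup C-2222 a) ≡ a
position-lookup zero = refl
position-lookup (suc zero) = refl
position-lookup (suc (suc zero)) = refl
position-lookup (suc (suc (suc zero))) = refl
position-lookup (suc (suc (suc (suc zero)))) = refl
position-lookup (suc (suc (suc (suc (suc zero))))) = refl

isFiberMatrix-2222 : IsFiberMatrix A-K4 b-2222 C-2222
isFiberMatrix-2222 =
    (λ x → mk⇔ (λ e → fiber-2222 x (·⇒·ℕ-b {x} e)) (C-2222-in-fiber x))
  , (λ a a' e → trans (sym (position-lookup a)) (trans (cong position e) (position-lookup a')))
  where
  ·⇒·ℕ-b : ∀ {x} → A-K4 · toℤ x ≡ toℤ b-2222 → A-K4 ·ℕ x ≡ b-2222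
  ·⇒·ℕ-b {x} e = toℤ-injective _ _ (trans (sym (toℤ-· A-K4 x)) e)

md≤2-K4 : ∀ b {k} (C : Config 6 k) → IsFiberMatrix A-K4 b C → Σ ℕ λ m → IsMD C m × m ≤ 2
md≤2-K4 b C fib = FiberMatrix.md≤2 A-K4 b C fib 2 (λ ()) sum-image swapConnected-K4

module Fiber-2222 = FiberMatrix.Nondegenerate A-K4 b-2222 C-2222 isFiberMatrix-2222 2 (λ ()) sum-image swapConnected-K4 (λ ())

relation-2222 : Fiber-2222.QuadraticRelation
relation-2222 = zero , suc zero , suc (suc (suc zero)) , suc (suc (suc zero)) , refl , λ ()

md-2222 : IsMD C-2222 2
md-2222 = Fiber-2222.md-quadratic relation-2222

mc-K4 : IsMC A-K4 2
mc-K4 = mc≤2 A-K4 swapConnected-K4 , mc≥2 A-K4 (matching zero) (matching (suc zero)) (λ ()) refl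

theorem3p1 :
  ((b : Vec ℕ 4) → InNA A-K4 b → (k : ℕ) (C : Config 6 k) → IsFiberMatrix A-K4 b C →
     Σ ℕ (λ m → IsMD C m × m ≤ 2))
  × Σ (Vec ℕ 4) (λ b → InNA A-K4 b × Σ ℕ (λ k → Σ (Config 6 k) (λ C → IsFiberMatrix A-K4 b C × IsMD C 2)))
  × IsMC A-K4 2
theorem3p1 =
    (λ b _ k C → md≤2-K4 b C)
  , (b-2222 , (lookup C-2222 zero , refl) , 6 , C-2222 , isFiberMatrix-2222 , md-2222)
  , mc-K4
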